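{- For any integer $n\geq 1$ we have \[ R(Q_n(x),Q_{n-1}(x)) = 2^n\binom{2n}{n}^{n-2}. \]
   Context: For each integer $n\geq 0$, $P_n(x),Q_n(x)\in\mathbb{Q}[x]$ denote the unique pair of polynomials with $\deg P_n\leq n$, $\deg Q_n\leq n$ satisfying $P_n(x)x^{n+1}+Q_n(x)(x+1)^{n+1}=1$. For polynomials $f(x)=a_0(x-\alpha_1)\cdots(x-\alpha_\mu)$ with $a_0\neq0$ and $g$, the resultant (with respect to $x$) is $R(f,g)=a_0^{\deg g}\prod_{i=1}^\mu g(\alpha_i)$. -}

module Defs where

open import Data.Nat as ℕ using (ℕ; zero; suc; _∸_; _≤?_)
open import Data.Integer as ℤ using (ℤ; +_; -[1+_])
open import Data.Rational as ℚ using (ℚ; 0ℚ; 1ℚ; _+_; _*_; -_; _/_)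
open import Data.Rational.Properties using (_≟_)
open import Data.Fin using (Fin; zero; suc; toℕ; punchIn)
open import Data.List using (List; []; _∷_; map; reverse; replicate; _++_; length)
open import Data.Bool using (Bool; true; false; if_then_else_)
open import Relation.Nullary.Decidable using (does; ⌊_⌋)

-- Univariate polynomials over ℚ as coefficient lists, lowest degree first.
Poly : Set
Poly = List ℚ

coeff : Poly → ℕ → ℚ
coeff []       _       = 0ℚ
coeff (a ∷ p)  zero    = a
coeff (a ∷ p)  (suc i) = coeff p i

infixl 6 _+ₚ_
infixl 7 _*ₚ_

_+ₚ_ : Poly → Poly → Poly
[]      +ₚ q       = q
(a ∷ p) +ₚ []      = a ∷ p
(a ∷ p) +ₚ (b ∷ q) = (a + b) ∷ (p +ₚ q)

_*ₚ_ : Poly → Poly → Poly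
[]      *ₚ q = []
(a ∷ p) *ₚ q = map (a *_) q +ₚ (0ℚ ∷ (p *ₚ q))

xPow : ℕ → Poly
xPow k = replicate k 0ℚ ++ (1ℚ ∷ [])

x+1Pow : ℕ → Poly
x+1Pow zero    = 1ℚ ∷ []
x+1Pow (suc k) = (1ℚ ∷ 1ℚ ∷ []) *ₚ x+1Pow k

onePoly : Poly
onePoly = 1ℚ ∷ []

_≈ₚ_ : Poly → Poly → Set
p ≈ₚ q = ∀ i → coeff p i ≡ coeff q i
  where open import Relation.Binary.PropositionalEquality using (_≡_)

dropZeros : List ℚ → List ℚ
dropZeros []      = []
dropZeros (a ∷ l) = if does (a ≟ 0ℚ) then dropZeros l else a ∷ l

trim : Poly → Poly
trim p = reverse (dropZeros (reverse p))

-- degree (the zero polynomial is given degree 0 by convention)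
deg : Poly → ℕ
deg p = length (trim p) ∸ 1

Σ : (n : ℕ) → (Fin n → ℚ) → ℚ
Σ zero    f = 0ℚ
Σ (suc n) f = f zero + Σ n (λ j → f (suc j))

sign : ℕ → ℚ
sign zero          = 1ℚ
sign (suc zero)    = - 1ℚ
sign (suc (suc k)) = sign k

det : (n : ℕ) → (Fin n → Fin n → ℚ) → ℚ
det zero    M = 1ℚ
det (suc n) M = Σ (suc n) (λ j → sign (toℕ j) * (M zero j * det n (λ i k → M (suc i) (punchIn j k))))

shiftRow : Poly → ℕ → ℕ → ℕ → ℚ
shiftRow f d r c =
  if ⌊ r ≤? c ⌋ then (if ⌊ c ∸ r ≤? d ⌋ then coeff f ((d ℕ.+ r) ∸ c) else 0ℚ) else 0ℚ

-- Sylvester matrix of f (degree m) and g (degree k): size m + k;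
-- first k rows: shifted coefficients of f (leading coefficient first),
-- last m rows: shifted coefficients of g.
sylvester : (f g : Poly) → Fin (deg f ℕ.+ deg g) → Fin (deg f ℕ.+ deg g) → ℚ
sylvester f g i j =
  if ⌊ toℕ i ℕ.<? deg g ⌋
    then shiftRow f (deg f) (toℕ i) (toℕ j)
    else shiftRow g (deg g) (toℕ i ∸ deg g) (toℕ j)

-- resultant R(f, g) = det of the Sylvester matrix
--   (= a₀^{deg g} ∏ g(αᵢ) for f = a₀ ∏ (x - αᵢ))
resultant : Poly → Poly → ℚ
resultant f g = det (deg f ℕ.+ deg g) (sylvester f g)

-- natural number power with integer exponent, as a rational (c^k, with c^{-m} = 1/c^m;
-- for c = 0 and negative exponents the value is 0 by convention, never used here)
natPowℤ : ℕ → ℤ → ℚ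
natPowℤ c (+ m)     = (+ (c ℕ.^ m)) / 1
natPowℤ c -[1+ m ]  with c ℕ.^ suc m
... | zero  = 0ℚ
... | suc d = (+ 1) / suc d

-- Let F and G be the coefficient series of Qₙ and Qₙ₋₁. The Bézout identity says that Qₙ is
-- (1+x)^-(n+1) truncated at degree n, so Qₙ = Σₖ (-1)ᵏ C(n+k,k) xᵏ, and comparing coefficients
-- gives (1+x) Qₙ = Qₙ₋₁ + d xⁿ (1+2x) with d = (-1)ⁿ C(2n-1,n).
-- Read every row of the Sylvester matrix as a truncated power series. Multiplying all rows by
-- one series with constant term 1 is a unitriangular column operation. Multiplying by 1/F turns
-- the n-1 rows coming from Qₙ into unit vectors, and the remaining n rows then hold shifted
-- coefficients of H = G/F = 1 + x - d xⁿ (1+2x)/F. Multiplying those by W = F/(1+2x) leaves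
-- two rows built from W and makes every other row -d times a unit vector, so the determinant
-- is ±(-d)ⁿ⁻² (W_{n-2} + d). The identity Σ_{k≤n} C(n+k,k) 2ⁿ⁻ᵏ = 4ⁿ gives
-- W_{n-2} + d = ±4ⁿ⁻¹, and everything multiplies out to 2ⁿ C(2n,n)ⁿ⁻².

module Submission where

open import Defs
open import Data.Nat using (ℕ; zero; suc; _≤_; _<_; _∸_; _^_; z≤n; s≤s)
import Data.Nat as ℕ
import Data.Nat.Properties as ℕₚ
open import Data.Nat.Combinatorics
  using (_C_; nCn≡1; nCk≡nC[n∸k]; nCk+nC[k+1]≡[n+1]C[k+1])
import Data.Integer as ℤ
import Data.Integer.Solver as ℤSolver
open import Data.Rational using (ℚ; 0ℚ; 1ℚ; ½; _+_; _*_; -_; _/_; toℚᵘ)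
open import Data.Rational.Properties
  using ( _≟_; +-assoc; +-comm; +-identityˡ; +-identityʳ; *-zeroˡ; *-zeroʳ
        ; *-identityˡ; *-identityʳ; *-comm; *-assoc; *-distribˡ-+; +-*-commutativeRing
        ; toℚᵘ-injective; toℚᵘ-homo-+; toℚᵘ-fromℚᵘ; toℚᵘ-cong)
import Data.Rational.Unnormalised as ℚᵘ
import Data.Rational.Unnormalised.Properties as ℚᵘₚ
open import Data.Rational.Solver using (module +-*-Solver)
open +-*-Solver using (solve; _:+_; _:*_; _:=_; :-_; con)
open import Algebra.Bundles using (CommutativeRing)
open import Algebra.Properties.CommutativeSemiring.Exp
  (CommutativeRing.commutativeSemiring +-*-commutativeRing)
  using (^-distrib-*) renaming (_^_ to _^ℚ_)
open import Data.Bool using (if_then_else_)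
open import Data.Empty using (⊥-elim)
open import Data.Fin using (Fin; toℕ; punchIn)
import Data.Fin as Fin
open import Data.List using ([]; _∷_; _++_; reverse; length; map)
import Data.List.Properties as Listₚ
open import Data.Product using (∃; _×_; _,_)
open import Data.Vec using (Vec; toList)
import Data.Vec as Vec
import Data.Vec.Properties as Vecₚ
open import Relation.Binary.Definitions using (tri<; tri≈; tri>)
open import Relation.Binary.PropositionalEquality
  using (_≡_; _≢_; _≗_; refl; sym; trans; cong; cong₂; subst; subst₂; module ≡-Reasoning)
open import Relation.Nullary using (¬_; Dec; yes; no)
open import Relation.Nullary.Decidable using (⌊_⌋)

open ≡-Reasoning

if-yes : ∀ {P A : Set} (P? : Dec P) {x y : A} → P → (if ⌊ P? ⌋ then x else y) ≡ x
if-yes (yes _) _ = refl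
if-yes (no ¬p) p = ⊥-elim (¬p p)

if-no : ∀ {P A : Set} (P? : Dec P) {x y : A} → ¬ P → (if ⌊ P? ⌋ then x else y) ≡ y
if-no (yes p) ¬p = ⊥-elim (¬p p)
if-no (no _)  _  = refl

∑ : ℕ → (ℕ → ℚ) → ℚ
∑ zero    f = 0ℚ
∑ (suc m) f = f 0 + ∑ m (λ j → f (suc j))

∑-cong : ∀ m {f g : ℕ → ℚ} → (∀ j → j < m → f j ≡ g j) → ∑ m f ≡ ∑ m g
∑-cong zero    h = refl
∑-cong (suc m) h = cong₂ _+_ (h 0 (s≤s z≤n)) (∑-cong m (λ j j<m → h (suc j) (s≤s j<m)))

∑-distrib-+ : ∀ m (f g : ℕ → ℚ) → ∑ m (λ j → f j + g j) ≡ ∑ m f + ∑ m g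
∑-distrib-+ zero    f g = sym (+-identityˡ 0ℚ)
∑-distrib-+ (suc m) f g =
  trans (cong (f 0 + g 0 +_) (∑-distrib-+ m (λ j → f (suc j)) (λ j → g (suc j))))
        (solve 4 (λ a b c d → (a :+ b) :+ (c :+ d) := (a :+ c) :+ (b :+ d)) refl
               (f 0) (g 0) (∑ m (λ j → f (suc j))) (∑ m (λ j → g (suc j))))

∑-scaleˡ : ∀ m (a : ℚ) (f : ℕ → ℚ) → ∑ m (λ j → a * f j) ≡ a * ∑ m f
∑-scaleˡ zero    a f = sym (*-zeroʳ a)
∑-scaleˡ (suc m) a f =
  trans (cong (a * f 0 +_) (∑-scaleˡ m a (λ j → f (suc j)))) (sym (*-distribˡ-+ a (f 0) _))

∑-zero : ∀ m {f : ℕ → ℚ} → (∀ j → j < m → f j ≡ 0ℚ) → ∑ m f ≡ 0ℚ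
∑-zero zero    h = refl
∑-zero (suc m) h =
  trans (cong₂ _+_ (h 0 (s≤s z≤n)) (∑-zero m (λ j j<m → h (suc j) (s≤s j<m)))) (+-identityˡ 0ℚ)

∑-last : ∀ m (f : ℕ → ℚ) → ∑ (suc m) f ≡ ∑ m f + f m
∑-last zero    f = trans (+-identityʳ (f 0)) (sym (+-identityˡ (f 0)))
∑-last (suc m) f = trans (cong (f 0 +_) (∑-last m (λ j → f (suc j)))) (sym (+-assoc (f 0) _ _))

∑-single : ∀ m k {f : ℕ → ℚ} → k < m → (∀ j → j < m → j ≢ k → f j ≡ 0ℚ) → ∑ m f ≡ f k
∑-single (suc m) zero    {f} _ h =
  trans (cong (f 0 +_) (∑-zero m (λ j j<m → h (suc j) (s≤s j<m) (λ ())))) (+-identityʳ (f 0))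
∑-single (suc m) (suc k) {f} (s≤s k<m) h =
  trans (cong₂ _+_ (h 0 (s≤s z≤n) (λ ()))
                   (∑-single m k k<m (λ j j<m j≢k → h (suc j) (s≤s j<m) (λ e → j≢k (ℕₚ.suc-injective e)))))
        (+-identityˡ _)

∑-cancelPair : ∀ m k {f : ℕ → ℚ} → suc k < m →
  (∀ j → j < m → j ≢ k → j ≢ suc k → f j ≡ 0ℚ) → f k + f (suc k) ≡ 0ℚ → ∑ m f ≡ 0ℚ
∑-cancelPair (suc (suc m)) zero {f} _ h pair =
  trans (sym (+-assoc (f 0) (f 1) _))
        (trans (cong₂ _+_ pair (∑-zero m (λ j j<m → h (suc (suc j)) (s≤s (s≤s j<m)) (λ ()) (λ ()))))
               (+-identityˡ 0ℚ))
∑-cancelPair (suc m) (suc k) {f} (s≤s k<m) h pair =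
  trans (cong₂ _+_ (h 0 (s≤s z≤n) (λ ()) (λ ()))
                   (∑-cancelPair m k k<m
                     (λ j j<m a b → h (suc j) (s≤s j<m) (λ e → a (ℕₚ.suc-injective e)) (λ e → b (ℕₚ.suc-injective e)))
                     pair))
        (+-identityˡ 0ℚ)

∑-ends : ∀ m (f : ℕ → ℚ) → (∀ k → 1 ≤ k → k ≤ m → f k ≡ 0ℚ) → ∑ (suc (suc m)) f ≡ f 0 + f (suc m)
∑-ends m f h = cong (f 0 +_) (∑-single (suc m) m (ℕₚ.n<1+n m)
  (λ j j< j≢m → h (suc j) (s≤s z≤n) (ℕₚ.≤∧≢⇒< (ℕₚ.≤-pred j<) j≢m)))

-- Formal power series

Series : Set
Series = ℕ → ℚ

infixl 6 _⊕_
infixr 8 _•_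
infixl 7 _⋆_
infixr 9 X·_ X^_·_ [1+X]·_ [1+X]^_·_

δ : Series
δ zero    = 1ℚ
δ (suc _) = 0ℚ

tail : Series → Series
tail a i = a (suc i)

_⊕_ : Series → Series → Series
(a ⊕ b) e = a e + b e

_•_ : ℚ → Series → Series
(k • a) e = k * a e

X·_ : Series → Series
(X· a) zero    = 0ℚ
(X· a) (suc e) = a e

X^_·_ : ℕ → Series → Series
X^ zero  · a = a
X^ suc s · a = X· X^ s · a

[1+X]·_ : Series → Series
[1+X]· a = a ⊕ X· a

[1+X]^_·_ : ℕ → Series → Series
[1+X]^ zero  · a = a
[1+X]^ suc m · a = [1+X]· [1+X]^ m · a

_⋆_ : Series → Series → Series
(a ⋆ b) zero    = a 0 * b 0
(a ⋆ b) (suc e) = a 0 * b (suc e) + (tail a ⋆ b) e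

X·-cong : ∀ {a b} → a ≗ b → X· a ≗ X· b
X·-cong h zero    = refl
X·-cong h (suc e) = h e

X^·-cong : ∀ s {a b} → a ≗ b → X^ s · a ≗ X^ s · b
X^·-cong zero    h = h
X^·-cong (suc s) h = X·-cong (X^·-cong s h)

[1+X]·-cong : ∀ {a b} → a ≗ b → [1+X]· a ≗ [1+X]· b
[1+X]·-cong h e = cong₂ _+_ (h e) (X·-cong h e)

[1+X]^·-cong : ∀ m {a b} → a ≗ b → [1+X]^ m · a ≗ [1+X]^ m · b
[1+X]^·-cong zero    h = h
[1+X]^·-cong (suc m) h = [1+X]·-cong ([1+X]^·-cong m h)

X^·-+ : ∀ s a t → (X^ s · a) (s ℕ.+ t) ≡ a t
X^·-+ zero    a t = refl
X^·-+ (suc s) a t = X^·-+ s a t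

X^·-+ʳ : ∀ s a t → (X^ s · a) (t ℕ.+ s) ≡ a t
X^·-+ʳ s a t = trans (cong (X^ s · a) (ℕₚ.+-comm t s)) (X^·-+ s a t)

X^·-< : ∀ s a e → e < s → (X^ s · a) e ≡ 0ℚ
X^·-< (suc s) a zero    _         = refl
X^·-< (suc s) a (suc e) (s≤s e<s) = X^·-< s a e e<s

X^·-++ : ∀ r s a t → (X^ (r ℕ.+ s) · a) (r ℕ.+ t) ≡ (X^ s · a) t
X^·-++ zero    s a t = refl
X^·-++ (suc r) s a t = X^·-++ r s a t

X^·-≤ : ∀ s a t → t ≤ s → (X^ s · a) t ≡ a 0 * (X^ s · δ) t
X^·-≤ zero    a zero    _         = sym (*-identityʳ (a 0))
X^·-≤ (suc s) a zero    _         = sym (*-zeroʳ (a 0))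
X^·-≤ (suc s) a (suc t) (s≤s t≤s) = X^·-≤ s a t t≤s

X^·-• : ∀ s k a → X^ s · (k • a) ≗ k • X^ s · a
X^·-• zero    k a e       = refl
X^·-• (suc s) k a zero    = sym (*-zeroʳ k)
X^·-• (suc s) k a (suc e) = X^·-• s k a e

X^·δ-diag : ∀ s → (X^ s · δ) s ≡ 1ℚ
X^·δ-diag s = X^·-+ʳ s δ 0

X^·δ-off : ∀ s e → e ≢ s → (X^ s · δ) e ≡ 0ℚ
X^·δ-off zero    zero    e≢s = ⊥-elim (e≢s refl)
X^·δ-off zero    (suc e) _   = refl
X^·δ-off (suc s) zero    _   = refl
X^·δ-off (suc s) (suc e) e≢s = X^·δ-off s e (λ e≡s → e≢s (cong suc e≡s))

⋆-cong : ∀ {a a′ b b′} → a ≗ a′ → b ≗ b′ → a ⋆ b ≗ a′ ⋆ b′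
⋆-cong ha hb zero    = cong₂ _*_ (ha 0) (hb 0)
⋆-cong ha hb (suc e) =
  cong₂ _+_ (cong₂ _*_ (ha 0) (hb (suc e))) (⋆-cong (λ i → ha (suc i)) hb e)

⋆-congˡ : ∀ {a a′} b → a ≗ a′ → a ⋆ b ≗ a′ ⋆ b
⋆-congˡ b h = ⋆-cong h (λ _ → refl)

⋆-congʳ : ∀ a {b b′} → b ≗ b′ → a ⋆ b ≗ a ⋆ b′
⋆-congʳ a h = ⋆-cong (λ _ → refl) h

⋆-congˡ-≤ : ∀ e {a a′} b → (∀ i → i ≤ e → a i ≡ a′ i) → (a ⋆ b) e ≡ (a′ ⋆ b) e
⋆-congˡ-≤ zero    b h = cong (_* b 0) (h 0 z≤n)
⋆-congˡ-≤ (suc e) b h =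
  cong₂ _+_ (cong (_* b (suc e)) (h 0 z≤n)) (⋆-congˡ-≤ e b (λ i i≤e → h (suc i) (s≤s i≤e)))

⋆-congʳ-≤ : ∀ e a {b b′} → (∀ i → i ≤ e → b i ≡ b′ i) → (a ⋆ b) e ≡ (a ⋆ b′) e
⋆-congʳ-≤ zero    a h = cong (a 0 *_) (h 0 z≤n)
⋆-congʳ-≤ (suc e) a h =
  cong₂ _+_ (cong (a 0 *_) (h (suc e) ℕₚ.≤-refl)) (⋆-congʳ-≤ e (tail a) (λ i i≤e → h i (ℕₚ.m≤n⇒m≤1+n i≤e)))

⋆-zeroˡ : ∀ a b → (∀ i → a i ≡ 0ℚ) → ∀ e → (a ⋆ b) e ≡ 0ℚ
⋆-zeroˡ a b h zero    = trans (cong (_* b 0) (h 0)) (*-zeroˡ (b 0))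
⋆-zeroˡ a b h (suc e) =
  trans (cong₂ _+_ (trans (cong (_* b (suc e)) (h 0)) (*-zeroˡ (b (suc e))))
                   (⋆-zeroˡ (tail a) b (λ i → h (suc i)) e))
        (+-identityˡ 0ℚ)

⋆-identityˡ : ∀ a → δ ⋆ a ≗ a
⋆-identityˡ a zero    = *-identityˡ (a 0)
⋆-identityˡ a (suc e) =
  trans (cong₂ _+_ (*-identityˡ (a (suc e))) (⋆-zeroˡ (tail δ) a (λ _ → refl) e)) (+-identityʳ (a (suc e)))

⋆-X·ˡ : ∀ a b → X· a ⋆ b ≗ X· (a ⋆ b)
⋆-X·ˡ a b zero    = *-zeroˡ (b 0)
⋆-X·ˡ a b (suc e) = trans (cong (_+ (a ⋆ b) e) (*-zeroˡ (b (suc e)))) (+-identityˡ ((a ⋆ b) e))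

⋆-distribʳ-⊕ : ∀ a b c → (a ⊕ b) ⋆ c ≗ a ⋆ c ⊕ b ⋆ c
⋆-distribʳ-⊕ a b c zero =
  solve 3 (λ x y z → (x :+ y) :* z := x :* z :+ y :* z) refl (a 0) (b 0) (c 0)
⋆-distribʳ-⊕ a b c (suc e) =
  trans (cong ((a 0 + b 0) * c (suc e) +_) (⋆-distribʳ-⊕ (tail a) (tail b) c e))
        (solve 5 (λ x y z p q → (x :+ y) :* z :+ (p :+ q) := (x :* z :+ p) :+ (y :* z :+ q)) refl
               (a 0) (b 0) (c (suc e)) ((tail a ⋆ c) e) ((tail b ⋆ c) e))

⋆-•ˡ : ∀ k a c → (k • a) ⋆ c ≗ k • (a ⋆ c)
⋆-•ˡ k a c zero    = *-assoc k (a 0) (c 0)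
⋆-•ˡ k a c (suc e) =
  trans (cong ((k * a 0) * c (suc e) +_) (⋆-•ˡ k (tail a) c e))
        (solve 4 (λ k x z p → (k :* x) :* z :+ k :* p := k :* (x :* z :+ p)) refl
               k (a 0) (c (suc e)) ((tail a ⋆ c) e))

⋆-unfold : ∀ a b → a ⋆ b ≗ a 0 • b ⊕ X· (tail a ⋆ b)
⋆-unfold a b zero    = sym (+-identityʳ _)
⋆-unfold a b (suc e) = refl

⋆-assoc : ∀ a b c → (a ⋆ b) ⋆ c ≗ a ⋆ (b ⋆ c)
⋆-assoc a b c e = begin
  ((a ⋆ b) ⋆ c) e                                     ≡⟨ ⋆-congˡ c (⋆-unfold a b) e ⟩
  ((a 0 • b ⊕ X· (tail a ⋆ b)) ⋆ c) e                  ≡⟨ ⋆-distribʳ-⊕ (a 0 • b) (X· (tail a ⋆ b)) c e ⟩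
  ((a 0 • b) ⋆ c) e + (X· (tail a ⋆ b) ⋆ c) e          ≡⟨ cong₂ _+_ (⋆-•ˡ (a 0) b c e) (⋆-X·ˡ (tail a ⋆ b) c e) ⟩
  a 0 * (b ⋆ c) e + (X· ((tail a ⋆ b) ⋆ c)) e          ≡⟨ fold e ⟩
  (a ⋆ (b ⋆ c)) e                                     ∎
  where
  fold : ∀ e → a 0 * (b ⋆ c) e + (X· ((tail a ⋆ b) ⋆ c)) e ≡ (a ⋆ (b ⋆ c)) e
  fold zero    = +-identityʳ _
  fold (suc e) = cong (a 0 * (b ⋆ c) (suc e) +_) (⋆-assoc (tail a) b c e)

⋆-comm : ∀ a b → a ⋆ b ≗ b ⋆ a
⋆-comm a b zero          = *-comm (a 0) (b 0)
⋆-comm a b (suc zero)    =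
  solve 4 (λ a0 a1 b0 b1 → a0 :* b1 :+ a1 :* b0 := b0 :* a1 :+ b1 :* a0) refl (a 0) (a 1) (b 0) (b 1)
⋆-comm a b (suc (suc e)) = begin
  a 0 * b (2 ℕ.+ e) + (tail a ⋆ b) (suc e)
    ≡⟨ cong (a 0 * b (2 ℕ.+ e) +_) (⋆-comm (tail a) b (suc e)) ⟩
  a 0 * b (2 ℕ.+ e) + (b 0 * a (2 ℕ.+ e) + (tail b ⋆ tail a) e)
    ≡⟨ cong (λ z → a 0 * b (2 ℕ.+ e) + (b 0 * a (2 ℕ.+ e) + z)) (⋆-comm (tail b) (tail a) e) ⟩
  a 0 * b (2 ℕ.+ e) + (b 0 * a (2 ℕ.+ e) + (tail a ⋆ tail b) e)
    ≡⟨ solve 3 (λ x y z → x :+ (y :+ z) := y :+ (x :+ z))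
       refl (a 0 * b (2 ℕ.+ e)) (b 0 * a (2 ℕ.+ e)) ((tail a ⋆ tail b) e) ⟩
  b 0 * a (2 ℕ.+ e) + (a 0 * b (2 ℕ.+ e) + (tail a ⋆ tail b) e)
    ≡⟨ cong (b 0 * a (2 ℕ.+ e) +_) (⋆-comm a (tail b) (suc e)) ⟩
  b 0 * a (2 ℕ.+ e) + (tail b ⋆ a) (suc e) ∎

⋆-identityʳ : ∀ a → a ⋆ δ ≗ a
⋆-identityʳ a e = trans (⋆-comm a δ e) (⋆-identityˡ a e)

⋆-X·ʳ : ∀ a b → a ⋆ X· b ≗ X· (a ⋆ b)
⋆-X·ʳ a b e = trans (⋆-comm a (X· b) e) (trans (⋆-X·ˡ b a e) (X·-cong (⋆-comm b a) e))

⋆-X^·ʳ : ∀ s a b → a ⋆ X^ s · b ≗ X^ s · (a ⋆ b)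
⋆-X^·ʳ zero    a b e = refl
⋆-X^·ʳ (suc s) a b e = trans (⋆-X·ʳ a (X^ s · b) e) (X·-cong (⋆-X^·ʳ s a b) e)

⋆-distribˡ-⊕ : ∀ a b c → a ⋆ (b ⊕ c) ≗ a ⋆ b ⊕ a ⋆ c
⋆-distribˡ-⊕ a b c e =
  trans (⋆-comm a (b ⊕ c) e) (trans (⋆-distribʳ-⊕ b c a e) (cong₂ _+_ (⋆-comm b a e) (⋆-comm c a e)))

⋆-•ʳ : ∀ k a c → a ⋆ (k • c) ≗ k • (a ⋆ c)
⋆-•ʳ k a c e = trans (⋆-comm a (k • c) e) (trans (⋆-•ˡ k c a e) (cong (k *_) (⋆-comm c a e)))

⋆-[1+X]ʳ : ∀ a b → a ⋆ [1+X]· b ≗ [1+X]· (a ⋆ b)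
⋆-[1+X]ʳ a b e = trans (⋆-distribˡ-⊕ a b (X· b) e) (cong ((a ⋆ b) e +_) (⋆-X·ʳ a b e))

⋆-[1+X]^ʳ : ∀ m a b → a ⋆ [1+X]^ m · b ≗ [1+X]^ m · (a ⋆ b)
⋆-[1+X]^ʳ zero    a b e = refl
⋆-[1+X]^ʳ (suc m) a b e = trans (⋆-[1+X]ʳ a ([1+X]^ m · b) e) ([1+X]·-cong (⋆-[1+X]^ʳ m a b) e)

⋆-as-∑ : ∀ e a b → (a ⋆ b) e ≡ ∑ (suc e) (λ t → a t * b (e ∸ t))
⋆-as-∑ zero    a b = sym (+-identityʳ _)
⋆-as-∑ (suc e) a b = cong (a 0 * b (suc e) +_) (⋆-as-∑ e (tail a) b)

-- Determinants of ℕ-indexed matrices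

Matrix : Set
Matrix = ℕ → ℕ → ℚ

punchInℕ : ℕ → ℕ → ℕ
punchInℕ zero    k       = suc k
punchInℕ (suc j) zero    = zero
punchInℕ (suc j) (suc k) = suc (punchInℕ j k)

minor : ℕ → Matrix → Matrix
minor j M i k = M (suc i) (punchInℕ j k)

-- Defs.det for ℕ-indexed matrices; only the top-left N × N block is read.
detℕ : ℕ → Matrix → ℚ
detℕ zero    M = 1ℚ
detℕ (suc N) M = ∑ (suc N) (λ j → sign j * (M 0 j * detℕ N (minor j M)))

punchInℕ-below : ∀ j k → k < j → punchInℕ j k ≡ k
punchInℕ-below (suc j) zero    _         = refl
punchInℕ-below (suc j) (suc k) (s≤s k<j) = cong suc (punchInℕ-below j k k<j)

punchInℕ-above : ∀ j k → j ≤ k → punchInℕ j k ≡ suc k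
punchInℕ-above zero    k       _         = refl
punchInℕ-above (suc j) (suc k) (s≤s j≤k) = cong suc (punchInℕ-above j k j≤k)

punchInℕ-≢ : ∀ j k → punchInℕ j k ≢ j
punchInℕ-≢ zero    k       ()
punchInℕ-≢ (suc j) zero    ()
punchInℕ-≢ (suc j) (suc k) e = punchInℕ-≢ j k (ℕₚ.suc-injective e)

punchInℕ-injective : ∀ j a b → punchInℕ j a ≡ punchInℕ j b → a ≡ b
punchInℕ-injective zero    a       b       e = ℕₚ.suc-injective e
punchInℕ-injective (suc j) zero    zero    _ = refl
punchInℕ-injective (suc j) (suc a) (suc b) e = cong suc (punchInℕ-injective j a b (ℕₚ.suc-injective e))

punchInℕ-bounded : ∀ N j k → k < N → punchInℕ j k < suc N
punchInℕ-bounded N j k k<N = ℕₚ.≤-<-trans (punchInℕ-≤ j k) (s≤s k<N)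
  where
  punchInℕ-≤ : ∀ j k → punchInℕ j k ≤ suc k
  punchInℕ-≤ zero    k       = ℕₚ.≤-refl
  punchInℕ-≤ (suc j) zero    = z≤n
  punchInℕ-≤ (suc j) (suc k) = s≤s (punchInℕ-≤ j k)

punchInℕ-surjective : ∀ N j k → j ≢ k → j < suc N → k < suc N → ∃ λ k′ → punchInℕ j k′ ≡ k × k′ < N
punchInℕ-surjective N       zero    zero    j≢k _ _ = ⊥-elim (j≢k refl)
punchInℕ-surjective N       zero    (suc k) _ _ (s≤s k<N) = k , refl , k<N
punchInℕ-surjective zero    (suc j) _       _ (s≤s ()) _
punchInℕ-surjective (suc N) (suc j) zero    _ _ _ = zero , refl , s≤s z≤n
punchInℕ-surjective (suc N) (suc j) (suc k) j≢k (s≤s j<) (s≤s k<)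
  with punchInℕ-surjective N j k (λ e → j≢k (cong suc e)) j< k<
... | k′ , e , k′<N = suc k′ , cong suc e , s≤s k′<N

sign-suc : ∀ k → sign (suc k) ≡ - sign k
sign-suc zero          = refl
sign-suc (suc zero)    = refl
sign-suc (suc (suc k)) = sign-suc k

detℕ-cong : ∀ N {M M′ : Matrix} → (∀ i k → i < N → k < N → M i k ≡ M′ i k) → detℕ N M ≡ detℕ N M′
detℕ-cong zero    h = refl
detℕ-cong (suc N) h = ∑-cong (suc N) (λ j j< → cong (sign j *_) (cong₂ _*_ (h 0 j (s≤s z≤n) j<)
  (detℕ-cong N (λ i k i< k< → h (suc i) (punchInℕ j k) (s≤s i<) (punchInℕ-bounded N j k k<)))))

detℕ-single : ∀ N (M : Matrix) j → j < suc N → (∀ c → c < suc N → c ≢ j → M 0 c ≡ 0ℚ) →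
  detℕ (suc N) M ≡ sign j * (M 0 j * detℕ N (minor j M))
detℕ-single N M j j< h = ∑-single (suc N) j j< (λ c c< c≢j →
  trans (cong (λ z → sign c * (z * detℕ N (minor c M))) (h c c< c≢j))
        (solve 2 (λ s d → s :* (con 0ℚ :* d) := con 0ℚ) refl (sign c) (detℕ N (minor c M))))

detℕ-zeroRow : ∀ N (M : Matrix) r → r < N → (∀ c → c < N → M r c ≡ 0ℚ) → detℕ N M ≡ 0ℚ
detℕ-zeroRow (suc N) M zero _ h = ∑-zero (suc N) (λ j j< →
  trans (cong (λ z → sign j * (z * detℕ N (minor j M))) (h j j<))
        (solve 2 (λ s d → s :* (con 0ℚ :* d) := con 0ℚ) refl (sign j) (detℕ N (minor j M))))
detℕ-zeroRow (suc N) M (suc r) (s≤s r<N) h = ∑-zero (suc N) (λ j _ →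
  trans (cong (λ z → sign j * (M 0 j * z))
              (detℕ-zeroRow N (minor j M) r r<N (λ c c< → h (punchInℕ j c) (punchInℕ-bounded N j c c<))))
        (solve 2 (λ s x → s :* (x :* con 0ℚ) := con 0ℚ) refl (sign j) (M 0 j)))

detℕ-diagonal : ∀ N (M : Matrix) d → (∀ i k → i < N → k < N → i ≢ k → M i k ≡ 0ℚ) →
  (∀ i → i < N → M i i ≡ d) → detℕ N M ≡ d ^ℚ N
detℕ-diagonal zero    M d off diag = refl
detℕ-diagonal (suc N) M d off diag =
  trans (detℕ-single N M 0 (s≤s z≤n) (λ c c< c≢0 → off 0 c (s≤s z≤n) c< (λ e → c≢0 (sym e))))
        (trans (cong₂ (λ x y → 1ℚ * (x * y)) (diag 0 (s≤s z≤n))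
                      (detℕ-diagonal N (minor 0 M) d
                        (λ i k i< k< i≢k → off (suc i) (suc k) (s≤s i<) (s≤s k<) (λ e → i≢k (ℕₚ.suc-injective e)))
                        (λ i i< → diag (suc i) (s≤s i<))))
               (*-identityˡ _))

detℕ-unitRows : ∀ m n (M : Matrix) →
  (∀ r → r < m → M r (n ℕ.+ r) ≡ 1ℚ) →
  (∀ r c → r < m → c < m ℕ.+ n → c ≢ n ℕ.+ r → M r c ≡ 0ℚ) →
  detℕ (m ℕ.+ n) M ≡ sign n ^ℚ m * detℕ n (λ i → M (m ℕ.+ i))
detℕ-unitRows zero    n M unit off = sym (*-identityˡ _)
detℕ-unitRows (suc m) n M unit off = begin
  detℕ (suc m ℕ.+ n) M
    ≡⟨ detℕ-single (m ℕ.+ n) M n (s≤s (ℕₚ.m≤n+m n m)) row0 ⟩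
  sign n * (M 0 n * detℕ (m ℕ.+ n) (minor n M))
    ≡⟨ cong₂ (λ x y → sign n * (x * y)) M0n≡1 ih ⟩
  sign n * (1ℚ * (sign n ^ℚ m * detℕ n (λ i → minor n M (m ℕ.+ i))))
    ≡⟨ cong (λ z → sign n * (1ℚ * (sign n ^ℚ m * z))) (detℕ-cong n lower) ⟩
  sign n * (1ℚ * (sign n ^ℚ m * detℕ n (λ i → M (suc m ℕ.+ i))))
    ≡⟨ solve 3 (λ s q d → s :* (con 1ℚ :* (q :* d)) := (s :* q) :* d) refl (sign n) (sign n ^ℚ m) _ ⟩
  sign n ^ℚ suc m * detℕ n (λ i → M (suc m ℕ.+ i)) ∎
  where
  row0 : ∀ c → c < suc m ℕ.+ n → c ≢ n → M 0 c ≡ 0ℚ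
  row0 c c< c≢n = off 0 c (s≤s z≤n) c< (λ e → c≢n (trans e (ℕₚ.+-identityʳ n)))
  M0n≡1 : M 0 n ≡ 1ℚ
  M0n≡1 = trans (cong (M 0) (sym (ℕₚ.+-identityʳ n))) (unit 0 (s≤s z≤n))
  punch-diag : ∀ r → punchInℕ n (n ℕ.+ r) ≡ n ℕ.+ suc r
  punch-diag r = trans (punchInℕ-above n (n ℕ.+ r) (ℕₚ.m≤m+n n r)) (sym (ℕₚ.+-suc n r))
  ih : detℕ (m ℕ.+ n) (minor n M) ≡ sign n ^ℚ m * detℕ n (λ i → minor n M (m ℕ.+ i))
  ih = detℕ-unitRows m n (minor n M)
         (λ r r< → trans (cong (M (suc r)) (punch-diag r)) (unit (suc r) (s≤s r<)))
         (λ r c r< c< c≢ → off (suc r) (punchInℕ n c) (s≤s r<) (punchInℕ-bounded (m ℕ.+ n) n c c<)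
            (λ e → c≢ (punchInℕ-injective n c (n ℕ.+ r) (trans e (sym (punch-diag r))))))
  lower : ∀ i k → i < n → k < n → minor n M (m ℕ.+ i) k ≡ M (suc m ℕ.+ i) k
  lower i k _ k<n = cong (M (suc m ℕ.+ i)) (punchInℕ-below n k k<n)

detℕ-lowerRowsSubdiagonal : ∀ K (B : Matrix) a → (∀ i → i < K → B (suc i) i ≡ a) →
  (∀ i c → i < K → c ≤ K → c ≢ i → B (suc i) c ≡ 0ℚ) →
  detℕ (suc K) B ≡ sign K * (B 0 K * a ^ℚ K)
detℕ-lowerRowsSubdiagonal K B a diag off =
  trans (∑-single (suc K) K (ℕₚ.n<1+n K) vanish) (cong (λ z → sign K * (B 0 K * z)) minorK)
  where
  vanish : ∀ j → j < suc K → j ≢ K → sign j * (B 0 j * detℕ K (minor j B)) ≡ 0ℚ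
  vanish j j< j≢K = trans
    (cong (λ z → sign j * (B 0 j * z))
          (detℕ-zeroRow K (minor j B) j j<K
            (λ c c< → off j (punchInℕ j c) j<K (ℕₚ.≤-pred (punchInℕ-bounded K j c c<)) (punchInℕ-≢ j c))))
    (solve 2 (λ s x → s :* (x :* con 0ℚ) := con 0ℚ) refl (sign j) (B 0 j))
    where
    j<K : j < K
    j<K = ℕₚ.≤∧≢⇒< (ℕₚ.≤-pred j<) j≢K
  minorK : detℕ K (minor K B) ≡ a ^ℚ K
  minorK = detℕ-diagonal K (minor K B) a
    (λ i k i< k< i≢k → trans (cong (B (suc i)) (punchInℕ-below K k k<)) (off i k i< (ℕₚ.<⇒≤ k<) (λ e → i≢k (sym e))))
    (λ i i< → trans (cong (B (suc i)) (punchInℕ-below K i i<)) (diag i i<))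

detℕ-lowerRowsDiagonal : ∀ K (B : Matrix) a → (∀ i → i < K → B (suc i) (suc i) ≡ a) →
  (∀ i c → i < K → c ≤ K → c ≢ suc i → B (suc i) c ≡ 0ℚ) →
  detℕ (suc K) B ≡ B 0 0 * a ^ℚ K
detℕ-lowerRowsDiagonal K B a diag off =
  trans (∑-single (suc K) 0 (s≤s z≤n) vanish) (trans (*-identityˡ _) (cong (B 0 0 *_) minor0))
  where
  vanish : ∀ j → j < suc K → j ≢ 0 → sign j * (B 0 j * detℕ K (minor j B)) ≡ 0ℚ
  vanish zero    _         j≢0 = ⊥-elim (j≢0 refl)
  vanish (suc j) (s≤s j<K) _   = trans
    (cong (λ z → sign (suc j) * (B 0 (suc j) * z))
          (detℕ-zeroRow K (minor (suc j) B) j j<K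
            (λ c c< → off j (punchInℕ (suc j) c) j<K (ℕₚ.≤-pred (punchInℕ-bounded K (suc j) c c<)) (punchInℕ-≢ (suc j) c))))
    (solve 2 (λ s x → s :* (x :* con 0ℚ) := con 0ℚ) refl (sign (suc j)) (B 0 (suc j)))
  minor0 : detℕ K (minor 0 B) ≡ a ^ℚ K
  minor0 = detℕ-diagonal K (minor 0 B) a
    (λ i k i< k< i≢k → off i (suc k) i< k< (λ e → i≢k (sym (ℕₚ.suc-injective e)))) diag

detℕ-linearInColumn : ∀ N k (M M₁ M₂ : Matrix) (b : ℚ) → k < N →
  (∀ i c → c ≢ k → M i c ≡ M₁ i c) → (∀ i c → c ≢ k → M i c ≡ M₂ i c) →
  (∀ i → M i k ≡ M₁ i k + b * M₂ i k) → detℕ N M ≡ detℕ N M₁ + b * detℕ N M₂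
detℕ-linearInColumn (suc N) k M M₁ M₂ b k< h₁ h₂ hk =
  trans (∑-cong (suc N) term)
        (trans (∑-distrib-+ (suc N) T₁ (λ j → b * T₂ j)) (cong (∑ (suc N) T₁ +_) (∑-scaleˡ (suc N) b T₂)))
  where
  T₁ T₂ : ℕ → ℚ
  T₁ j = sign j * (M₁ 0 j * detℕ N (minor j M₁))
  T₂ j = sign j * (M₂ 0 j * detℕ N (minor j M₂))
  term : ∀ j → j < suc N → sign j * (M 0 j * detℕ N (minor j M)) ≡ T₁ j + b * T₂ j
  term j j< with j ℕ.≟ k
  ... | yes refl = begin
    sign j * (M 0 j * detℕ N (minor j M))
      ≡⟨ cong₂ (λ x d → sign j * (x * d)) (hk 0) d₁ ⟩
    sign j * ((M₁ 0 j + b * M₂ 0 j) * detℕ N (minor j M₁))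
      ≡⟨ solve 5 (λ s x y z d → s :* ((x :+ z :* y) :* d) := s :* (x :* d) :+ z :* (s :* (y :* d)))
         refl (sign j) (M₁ 0 j) (M₂ 0 j) b (detℕ N (minor j M₁)) ⟩
    T₁ j + b * (sign j * (M₂ 0 j * detℕ N (minor j M₁)))
      ≡⟨ cong (λ d → T₁ j + b * (sign j * (M₂ 0 j * d))) (trans (sym d₁) d₂) ⟩
    T₁ j + b * T₂ j ∎
    where
    d₁ : detℕ N (minor j M) ≡ detℕ N (minor j M₁)
    d₁ = detℕ-cong N {minor j M} {minor j M₁} (λ i c _ _ → h₁ (suc i) (punchInℕ j c) (punchInℕ-≢ j c))
    d₂ : detℕ N (minor j M) ≡ detℕ N (minor j M₂)
    d₂ = detℕ-cong N {minor j M} {minor j M₂} (λ i c _ _ → h₂ (suc i) (punchInℕ j c) (punchInℕ-≢ j c))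
  ... | no j≢k with punchInℕ-surjective N j k j≢k j< k<
  ...   | k′ , refl , k′< = begin
    sign j * (M 0 j * detℕ N (minor j M))
      ≡⟨ cong (λ z → sign j * (M 0 j * z)) ih ⟩
    sign j * (M 0 j * (detℕ N (minor j M₁) + b * detℕ N (minor j M₂)))
      ≡⟨ solve 5 (λ s x y z d → s :* (x :* (y :+ z :* d)) := s :* (x :* y) :+ z :* (s :* (x :* d)))
         refl (sign j) (M 0 j) (detℕ N (minor j M₁)) b (detℕ N (minor j M₂)) ⟩
    sign j * (M 0 j * detℕ N (minor j M₁)) + b * (sign j * (M 0 j * detℕ N (minor j M₂)))
      ≡⟨ cong₂ (λ x y → sign j * (x * detℕ N (minor j M₁)) + b * (sign j * (y * detℕ N (minor j M₂))))
               (h₁ 0 j j≢k) (h₂ 0 j j≢k) ⟩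
    T₁ j + b * T₂ j ∎
    where
    away : ∀ c → c ≢ k′ → punchInℕ j c ≢ punchInℕ j k′
    away c c≢k′ e = c≢k′ (punchInℕ-injective j c k′ e)
    ih : detℕ N (minor j M) ≡ detℕ N (minor j M₁) + b * detℕ N (minor j M₂)
    ih = detℕ-linearInColumn N k′ (minor j M) (minor j M₁) (minor j M₂) b k′<
           (λ i c c≢ → h₁ (suc i) (punchInℕ j c) (away c c≢))
           (λ i c c≢ → h₂ (suc i) (punchInℕ j c) (away c c≢))
           (λ i → hk (suc i))

punchInℕ-adjacentPreimage : ∀ N j k → j < suc N → suc k < suc N → j ≢ k → j ≢ suc k →
  ∃ λ k′ → punchInℕ j k′ ≡ k × punchInℕ j (suc k′) ≡ suc k × suc k′ < N
punchInℕ-adjacentPreimage N j k j< (s≤s k<) j≢k j≢k+1 with ℕₚ.<-cmp j k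
... | tri≈ _ j≡k _ = ⊥-elim (j≢k j≡k)
punchInℕ-adjacentPreimage N j (suc k) j< (s≤s k<) _ _ | tri< (s≤s j≤k) _ _ =
  k , punchInℕ-above j k j≤k , punchInℕ-above j (suc k) (ℕₚ.m≤n⇒m≤1+n j≤k) , k<
punchInℕ-adjacentPreimage N j k j< (s≤s k<) _ j≢k+1 | tri> _ _ k<j =
  k , punchInℕ-below j k k<j , punchInℕ-below j (suc k) k+1<j , ℕₚ.≤-trans k+1<j (ℕₚ.≤-pred j<)
  where
  k+1<j : suc k < j
  k+1<j = ℕₚ.≤∧≢⇒< k<j (λ e → j≢k+1 (sym e))

detℕ-adjacentEqualColumns : ∀ N k (M : Matrix) → suc k < N → (∀ i → M i k ≡ M i (suc k)) → detℕ N M ≡ 0ℚ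
detℕ-adjacentEqualColumns (suc N) k M k+1< hk = ∑-cancelPair (suc N) k k+1< other pair
  where
  punchIn-adjacent : ∀ (g : ℕ → ℚ) k c → g k ≡ g (suc k) → g (punchInℕ k c) ≡ g (punchInℕ (suc k) c)
  punchIn-adjacent g zero    zero    e = sym e
  punchIn-adjacent g zero    (suc c) e = refl
  punchIn-adjacent g (suc k) zero    e = refl
  punchIn-adjacent g (suc k) (suc c) e = punchIn-adjacent (λ x → g (suc x)) k c e
  other : ∀ j → j < suc N → j ≢ k → j ≢ suc k → sign j * (M 0 j * detℕ N (minor j M)) ≡ 0ℚ
  other j j< j≢k j≢k+1 with punchInℕ-adjacentPreimage N j k j< k+1< j≢k j≢k+1
  ... | k′ , e₁ , e₂ , k′+1< =
    trans (cong (λ z → sign j * (M 0 j * z))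
                (detℕ-adjacentEqualColumns N k′ (minor j M) k′+1<
                  (λ i → trans (cong (M (suc i)) e₁) (trans (hk (suc i)) (cong (M (suc i)) (sym e₂))))))
          (solve 2 (λ s x → s :* (x :* con 0ℚ) := con 0ℚ) refl (sign j) (M 0 j))
  sameMinor : detℕ N (minor k M) ≡ detℕ N (minor (suc k) M)
  sameMinor = detℕ-cong N (λ i c _ _ → punchIn-adjacent (M (suc i)) k c (hk (suc i)))
  pair : sign k * (M 0 k * detℕ N (minor k M)) + sign (suc k) * (M 0 (suc k) * detℕ N (minor (suc k) M)) ≡ 0ℚ
  pair =
    trans (cong₂ (λ s x → sign k * (M 0 k * detℕ N (minor k M)) + s * (x * detℕ N (minor (suc k) M)))
                 (sign-suc k) (sym (hk 0)))
    (trans (cong (λ d → sign k * (M 0 k * detℕ N (minor k M)) + (- sign k) * (M 0 k * d)) (sym sameMinor))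
           (solve 3 (λ s x d → s :* (x :* d) :+ (:- s) :* (x :* d) := con 0ℚ) refl (sign k) (M 0 k) (detℕ N (minor k M))))

data AdjacentView (k : ℕ) : ℕ → Set where
  at-k   : AdjacentView k k
  at-k+1 : AdjacentView k (suc k)
  away   : ∀ {c} → c ≢ k → c ≢ suc k → AdjacentView k c

adjacentView : ∀ k c → AdjacentView k c
adjacentView k c with c ℕ.≟ k | c ℕ.≟ suc k
... | yes refl | _          = at-k
... | no _     | yes refl   = at-k+1
... | no c≢k   | no c≢k+1   = away c≢k c≢k+1

replaceAdjacent : ℕ → (ℕ → ℚ) → (ℕ → ℚ) → Matrix → Matrix
replaceAdjacent k v w M i c with adjacentView k c
... | at-k     = v i
... | at-k+1   = w i
... | away _ _ = M i c

swapAdjacentColumns : ℕ → Matrix → Matrix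
swapAdjacentColumns k M = replaceAdjacent k (λ i → M i (suc k)) (λ i → M i k) M

module _ (k : ℕ) (v w : ℕ → ℚ) (M : Matrix) (i : ℕ) where

  replaceAdjacent-k : replaceAdjacent k v w M i k ≡ v i
  replaceAdjacent-k with adjacentView k k
  ... | at-k       = refl
  ... | away k≢k _ = ⊥-elim (k≢k refl)

  replaceAdjacent-k+1 : replaceAdjacent k v w M i (suc k) ≡ w i
  replaceAdjacent-k+1 with adjacentView k (suc k)
  ... | at-k+1         = refl
  ... | away _ k+1≢k+1 = ⊥-elim (k+1≢k+1 refl)

  replaceAdjacent-away : ∀ c → c ≢ k → c ≢ suc k → replaceAdjacent k v w M i c ≡ M i c
  replaceAdjacent-away c c≢k c≢k+1 with adjacentView k c
  ... | at-k     = ⊥-elim (c≢k refl)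
  ... | at-k+1   = ⊥-elim (c≢k+1 refl)
  ... | away _ _ = refl

  replaceAdjacent-leftFixed : ∀ v′ c → c ≢ k → replaceAdjacent k v w M i c ≡ replaceAdjacent k v′ w M i c
  replaceAdjacent-leftFixed v′ c c≢k with adjacentView k c
  ... | at-k     = ⊥-elim (c≢k refl)
  ... | at-k+1   = refl
  ... | away _ _ = refl

  replaceAdjacent-rightFixed : ∀ w′ c → c ≢ suc k → replaceAdjacent k v w M i c ≡ replaceAdjacent k v w′ M i c
  replaceAdjacent-rightFixed w′ c c≢k+1 with adjacentView k c
  ... | at-k     = refl
  ... | at-k+1   = ⊥-elim (c≢k+1 refl)
  ... | away _ _ = refl

module _ (N k : ℕ) (M : Matrix) (k+1<N : suc k < N) where

  private
    k<N : k < N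
    k<N = ℕₚ.<-trans (ℕₚ.n<1+n k) k+1<N

    D : (ℕ → ℚ) → (ℕ → ℚ) → ℚ
    D v w = detℕ N (replaceAdjacent k v w M)

    D-diagonal : ∀ v → D v v ≡ 0ℚ
    D-diagonal v = detℕ-adjacentEqualColumns N k _ k+1<N
      (λ i → trans (replaceAdjacent-k k v v M i) (sym (replaceAdjacent-k+1 k v v M i)))

    D-additiveˡ : ∀ v v′ w → D (λ i → v i + v′ i) w ≡ D v w + D v′ w
    D-additiveˡ v v′ w = trans
      (detℕ-linearInColumn N k _ _ _ 1ℚ k<N
        (λ i → replaceAdjacent-leftFixed k _ w M i v) (λ i → replaceAdjacent-leftFixed k _ w M i v′)
        (λ i → trans (replaceAdjacent-k k _ w M i)
               (cong₂ _+_ (sym (replaceAdjacent-k k v w M i))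
                      (trans (sym (*-identityˡ (v′ i))) (cong (1ℚ *_) (sym (replaceAdjacent-k k v′ w M i)))))))
      (cong (D v w +_) (*-identityˡ (D v′ w)))

    D-additiveʳ : ∀ v w w′ → D v (λ i → w i + w′ i) ≡ D v w + D v w′
    D-additiveʳ v w w′ = trans
      (detℕ-linearInColumn N (suc k) _ _ _ 1ℚ k+1<N
        (λ i → replaceAdjacent-rightFixed k v _ M i w) (λ i → replaceAdjacent-rightFixed k v _ M i w′)
        (λ i → trans (replaceAdjacent-k+1 k v _ M i)
               (cong₂ _+_ (sym (replaceAdjacent-k+1 k v w M i))
                      (trans (sym (*-identityˡ (w′ i))) (cong (1ℚ *_) (sym (replaceAdjacent-k+1 k v w′ M i)))))))
      (cong (D v w +_) (*-identityˡ (D v w′)))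

    a b : ℕ → ℚ
    a i = M i k
    b i = M i (suc k)

    D-unchanged : D a b ≡ detℕ N M
    D-unchanged = detℕ-cong N unchanged
      where
      unchanged : ∀ i c → i < N → c < N → replaceAdjacent k a b M i c ≡ M i c
      unchanged i c _ _ with adjacentView k c
      ... | at-k     = refl
      ... | at-k+1   = refl
      ... | away _ _ = refl

  detℕ-swapAdjacentColumns : detℕ N (swapAdjacentColumns k M) ≡ - detℕ N M
  detℕ-swapAdjacentColumns = begin
    D b a                        ≡⟨ solve 2 (λ x y → y := (x :+ y) :+ (:- x)) refl (D a b) (D b a) ⟩
    D a b + D b a + (- D a b)    ≡⟨ cong (_+ (- D a b)) antisymmetric ⟩
    0ℚ + (- D a b)               ≡⟨ +-identityˡ (- D a b) ⟩
    - D a b                      ≡⟨ cong -_ D-unchanged ⟩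
    - detℕ N M                   ∎
    where
    s : ℕ → ℚ
    s i = a i + b i
    antisymmetric : D a b + D b a ≡ 0ℚ
    antisymmetric = begin
      D a b + D b a                      ≡⟨ solve 2 (λ x y → x :+ y := (con 0ℚ :+ x) :+ (y :+ con 0ℚ)) refl (D a b) (D b a) ⟩
      (0ℚ + D a b) + (D b a + 0ℚ)        ≡⟨ cong₂ (λ p q → (p + D a b) + (D b a + q)) (sym (D-diagonal a)) (sym (D-diagonal b)) ⟩
      (D a a + D a b) + (D b a + D b b)  ≡⟨ sym (cong₂ _+_ (D-additiveʳ a a b) (D-additiveʳ b a b)) ⟩
      D a s + D b s                      ≡⟨ sym (D-additiveˡ a b s) ⟩
      D s s                              ≡⟨ D-diagonal s ⟩
      0ℚ                                 ∎

setColumn : ℕ → (ℕ → ℚ) → Matrix → Matrix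
setColumn k v M i c = if ⌊ c ℕ.≟ k ⌋ then v i else M i c

setColumn-same : ∀ k v M i → setColumn k v M i k ≡ v i
setColumn-same k v M i = if-yes (k ℕ.≟ k) refl

setColumn-other : ∀ k v M i c → c ≢ k → setColumn k v M i c ≡ M i c
setColumn-other k v M i c c≢k = if-no (c ℕ.≟ k) c≢k

detℕ-equalColumns : ∀ N (M : Matrix) k l → k < l → l < N → (∀ i → M i k ≡ M i l) → detℕ N M ≡ 0ℚ
detℕ-equalColumns N M k (suc l) k<l+1 l+1<N h with k ℕ.≟ l
... | yes refl = detℕ-adjacentEqualColumns N k M l+1<N h
... | no k≢l   = begin
  detℕ N M                              ≡⟨ solve 1 (λ x → x := :- (:- x)) refl (detℕ N M) ⟩
  - (- detℕ N M)                        ≡⟨ cong -_ (sym (detℕ-swapAdjacentColumns N l M l+1<N)) ⟩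
  - detℕ N (swapAdjacentColumns l M)    ≡⟨ cong -_ (detℕ-equalColumns N _ k l k<l l<N swapped) ⟩
  - 0ℚ                                  ≡⟨⟩
  0ℚ                                    ∎
  where
  k<l : k < l
  k<l = ℕₚ.≤∧≢⇒< (ℕₚ.≤-pred k<l+1) k≢l
  l<N : l < N
  l<N = ℕₚ.<-trans (ℕₚ.n<1+n l) l+1<N
  swapped : ∀ i → swapAdjacentColumns l M i k ≡ swapAdjacentColumns l M i l
  swapped i = trans (replaceAdjacent-away l _ _ M i k k≢l (λ e → ℕₚ.<-irrefl e (ℕₚ.m<n⇒m<1+n k<l)))
                    (trans (h i) (sym (replaceAdjacent-k l _ _ M i)))

detℕ-addColumnMultiple : ∀ N (M M′ : Matrix) k l b → k < N → l < N → k ≢ l →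
  (∀ i c → c ≢ k → M′ i c ≡ M i c) → (∀ i → M′ i k ≡ M i k + b * M i l) → detℕ N M′ ≡ detℕ N M
detℕ-addColumnMultiple N M M′ k l b k< l< k≢l same hk = begin
  detℕ N M′
    ≡⟨ detℕ-linearInColumn N k M′ M Mₗ b k< same (λ i c c≢k → trans (same i c c≢k) (sym (setColumn-other k vₗ M i c c≢k)))
       (λ i → trans (hk i) (cong (λ z → M i k + b * z) (sym (setColumn-same k vₗ M i)))) ⟩
  detℕ N M + b * detℕ N Mₗ
    ≡⟨ cong (λ z → detℕ N M + b * z) Mₗ-singular ⟩
  detℕ N M + b * 0ℚ
    ≡⟨ trans (cong (detℕ N M +_) (*-zeroʳ b)) (+-identityʳ _) ⟩
  detℕ N M ∎
  where
  vₗ : ℕ → ℚ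
  vₗ i = M i l
  Mₗ : Matrix
  Mₗ = setColumn k vₗ M
  l≢k : l ≢ k
  l≢k e = k≢l (sym e)
  Mₗ-singular : detℕ N Mₗ ≡ 0ℚ
  Mₗ-singular with ℕₚ.<-cmp k l
  ... | tri< k<l _ _ = detℕ-equalColumns N Mₗ k l k<l l<
                         (λ i → trans (setColumn-same k vₗ M i) (sym (setColumn-other k vₗ M i l l≢k)))
  ... | tri≈ _ k≡l _ = ⊥-elim (k≢l k≡l)
  ... | tri> _ _ l<k = detℕ-equalColumns N Mₗ l k l<k k<
                         (λ i → trans (setColumn-other k vₗ M i l l≢k) (sym (setColumn-same k vₗ M i)))

detℕ-addLaterColumns : ∀ m N (M : Matrix) k (W : ℕ → ℚ) → k ℕ.+ m < N →
  detℕ N (setColumn k (λ i → M i k + ∑ m (λ t → W t * M i (suc (k ℕ.+ t)))) M) ≡ detℕ N M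
detℕ-addLaterColumns zero N M k W _ = detℕ-cong N unchanged
  where
  unchanged : ∀ i c → i < N → c < N → setColumn k (λ i → M i k + 0ℚ) M i c ≡ M i c
  unchanged i c _ _ with c ℕ.≟ k
  ... | yes refl = +-identityʳ _
  ... | no _     = refl
detℕ-addLaterColumns (suc m) N M k W k+m+1<N =
  trans (detℕ-addColumnMultiple N Mₘ Mₘ₊₁ k l (W m) k<N l<N k≢l
          (λ i c c≢k → trans (setColumn-other k vₘ₊₁ M i c c≢k) (sym (setColumn-other k vₘ M i c c≢k)))
          (λ i → trans (setColumn-same k vₘ₊₁ M i)
                 (trans (cong (M i k +_) (∑-last m (λ t → W t * M i (suc (k ℕ.+ t)))))
                 (trans (sym (+-assoc (M i k) _ _))
                        (cong₂ (λ x y → x + W m * y) (sym (setColumn-same k vₘ M i)) (sym (setColumn-other k vₘ M i l l≢k)))))))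
        (detℕ-addLaterColumns m N M k W (ℕₚ.<-trans (ℕₚ.+-monoʳ-< k (ℕₚ.n<1+n m)) k+m+1<N))
  where
  l : ℕ
  l = suc (k ℕ.+ m)
  vₘ vₘ₊₁ : ℕ → ℚ
  vₘ   i = M i k + ∑ m (λ t → W t * M i (suc (k ℕ.+ t)))
  vₘ₊₁ i = M i k + ∑ (suc m) (λ t → W t * M i (suc (k ℕ.+ t)))
  Mₘ Mₘ₊₁ : Matrix
  Mₘ   = setColumn k vₘ M
  Mₘ₊₁ = setColumn k vₘ₊₁ M
  l<N : l < N
  l<N = subst (_< N) (ℕₚ.+-suc k m) k+m+1<N
  k<N : k < N
  k<N = ℕₚ.≤-<-trans (ℕₚ.m≤m+n k (suc m)) k+m+1<N
  k≢l : k ≢ l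
  k≢l e = ℕₚ.<-irrefl e (s≤s (ℕₚ.m≤m+n k m))
  l≢k : l ≢ k
  l≢k e = k≢l (sym e)

toeplitzTransform : ℕ → (ℕ → ℚ) → Matrix → Matrix
toeplitzTransform N W M i c = ∑ (N ∸ c) (λ t → W t * M i (c ℕ.+ t))

partialToeplitz : ℕ → (ℕ → ℚ) → Matrix → ℕ → Matrix
partialToeplitz N W M j i c = if ⌊ c ℕ.<? j ⌋ then toeplitzTransform N W M i c else M i c

partialToeplitz-< : ∀ N W M j i c → c < j → partialToeplitz N W M j i c ≡ toeplitzTransform N W M i c
partialToeplitz-< N W M j i c c<j = if-yes (c ℕ.<? j) c<j

partialToeplitz-≥ : ∀ N W M j i c → ¬ c < j → partialToeplitz N W M j i c ≡ M i c
partialToeplitz-≥ N W M j i c c≮j = if-no (c ℕ.<? j) c≮j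

toeplitzStepColumn : ℕ → (ℕ → ℚ) → Matrix → ℕ → ℕ → ℚ
toeplitzStepColumn N W M j i = P i j + ∑ (N ∸ suc j) (λ t → W (suc t) * P i (suc (j ℕ.+ t)))
  where
  P : Matrix
  P = partialToeplitz N W M j

partialToeplitz-suc : ∀ N W M j → W 0 ≡ 1ℚ → j < N → ∀ i c →
  partialToeplitz N W M (suc j) i c ≡ setColumn j (toeplitzStepColumn N W M j) (partialToeplitz N W M j) i c
partialToeplitz-suc N W M j w₀ j<N i c with ℕₚ.<-cmp c j
... | tri< c<j c≢j _ =
  trans (partialToeplitz-< N W M (suc j) i c (ℕₚ.m<n⇒m<1+n c<j))
        (trans (sym (partialToeplitz-< N W M j i c c<j))
               (sym (setColumn-other j (toeplitzStepColumn N W M j) (partialToeplitz N W M j) i c c≢j)))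
... | tri> _ c≢j j<c =
  trans (partialToeplitz-≥ N W M (suc j) i c (ℕₚ.≤⇒≯ j<c))
        (trans (sym (partialToeplitz-≥ N W M j i c (ℕₚ.<⇒≯ j<c)))
               (sym (setColumn-other j (toeplitzStepColumn N W M j) (partialToeplitz N W M j) i c c≢j)))
... | tri≈ _ refl _ = begin
  partialToeplitz N W M (suc c) i c
    ≡⟨ partialToeplitz-< N W M (suc c) i c (ℕₚ.n<1+n c) ⟩
  ∑ (N ∸ c) (λ t → W t * M i (c ℕ.+ t))
    ≡⟨ cong (λ z → ∑ z (λ t → W t * M i (c ℕ.+ t))) (ℕₚ.+-∸-assoc 1 j<N) ⟩
  W 0 * M i (c ℕ.+ 0) + ∑ m (λ t → W (suc t) * M i (c ℕ.+ suc t))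
    ≡⟨ cong₂ _+_ head (∑-cong m (λ t _ → cong (W (suc t) *_) (later t))) ⟩
  toeplitzStepColumn N W M c i
    ≡⟨ sym (setColumn-same c (toeplitzStepColumn N W M c) P i) ⟩
  setColumn c (toeplitzStepColumn N W M c) P i c ∎
  where
  m : ℕ
  m = N ∸ suc c
  P : Matrix
  P = partialToeplitz N W M c
  head : W 0 * M i (c ℕ.+ 0) ≡ P i c
  head = trans (cong₂ _*_ w₀ (cong (M i) (ℕₚ.+-identityʳ c)))
               (trans (*-identityˡ (M i c)) (sym (partialToeplitz-≥ N W M c i c (ℕₚ.<-irrefl refl))))
  later : ∀ t → M i (c ℕ.+ suc t) ≡ P i (suc (c ℕ.+ t))
  later t = trans (cong (M i) (ℕₚ.+-suc c t))
                  (sym (partialToeplitz-≥ N W M c i (suc (c ℕ.+ t)) (ℕₚ.<⇒≯ (s≤s (ℕₚ.m≤m+n c t)))))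

detℕ-toeplitz : ∀ N W (M : Matrix) → W 0 ≡ 1ℚ → detℕ N (toeplitzTransform N W M) ≡ detℕ N M
detℕ-toeplitz N W M w₀ =
  trans (detℕ-cong N (λ i c _ c<N → sym (partialToeplitz-< N W M N i c c<N))) (upTo N ℕₚ.≤-refl)
  where
  upTo : ∀ j → j ≤ N → detℕ N (partialToeplitz N W M j) ≡ detℕ N M
  upTo zero    _      = detℕ-cong N (λ i c _ _ → partialToeplitz-≥ N W M 0 i c (λ ()))
  upTo (suc j) j+1≤N  = begin
    detℕ N (partialToeplitz N W M (suc j))
      ≡⟨ detℕ-cong N (λ i c _ _ → partialToeplitz-suc N W M j w₀ j+1≤N i c) ⟩
    detℕ N (setColumn j (toeplitzStepColumn N W M j) (partialToeplitz N W M j))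
      ≡⟨ detℕ-addLaterColumns (N ∸ suc j) N (partialToeplitz N W M j) j (λ t → W (suc t)) j+m<N ⟩
    detℕ N (partialToeplitz N W M j)
      ≡⟨ upTo j (ℕₚ.<⇒≤ j+1≤N) ⟩
    detℕ N M ∎
    where
    j+m<N : j ℕ.+ (N ∸ suc j) < N
    j+m<N = subst (j ℕ.+ (N ∸ suc j) <_) (ℕₚ.m+[n∸m]≡n j+1≤N) (ℕₚ.n<1+n (j ℕ.+ (N ∸ suc j)))

-- Row i lists the coefficients of p i from degree D downwards, so multiplying every p i by W
-- adds to each column a combination of the columns to its right.
detℕ-⋆-rows : ∀ D (p : ℕ → Series) W → W 0 ≡ 1ℚ →
  detℕ (suc D) (λ i c → p i (D ∸ c)) ≡ detℕ (suc D) (λ i c → (W ⋆ p i) (D ∸ c))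
detℕ-⋆-rows D p W w₀ =
  trans (sym (detℕ-toeplitz (suc D) W (λ i c → p i (D ∸ c)) w₀)) (detℕ-cong (suc D) reindex)
  where
  reindex : ∀ i c → i < suc D → c < suc D →
    ∑ (suc D ∸ c) (λ t → W t * p i (D ∸ (c ℕ.+ t))) ≡ (W ⋆ p i) (D ∸ c)
  reindex i c _ (s≤s c≤D) =
    trans (cong (λ z → ∑ z (λ t → W t * p i (D ∸ (c ℕ.+ t)))) (ℕₚ.+-∸-assoc 1 c≤D))
          (trans (∑-cong (suc (D ∸ c)) (λ t _ → cong (λ z → W t * p i z) (sym (ℕₚ.∸-+-assoc D c t))))
                 (sym (⋆-as-∑ (D ∸ c) W (p i))))

Σ-cong : ∀ n {f g : Fin n → ℚ} → (∀ j → f j ≡ g j) → Σ n f ≡ Σ n g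
Σ-cong zero    h = refl
Σ-cong (suc n) h = cong₂ _+_ (h Fin.zero) (Σ-cong n (λ j → h (Fin.suc j)))

Σ-as-∑ : ∀ n (f : Fin n → ℚ) (g : ℕ → ℚ) → (∀ j → f j ≡ g (toℕ j)) → Σ n f ≡ ∑ n g
Σ-as-∑ zero    f g h = refl
Σ-as-∑ (suc n) f g h = cong₂ _+_ (h Fin.zero) (Σ-as-∑ n (λ j → f (Fin.suc j)) (λ j → g (suc j)) (λ j → h (Fin.suc j)))

toℕ-punchIn : ∀ {n} (j : Fin (suc n)) (k : Fin n) → toℕ (punchIn j k) ≡ punchInℕ (toℕ j) (toℕ k)
toℕ-punchIn Fin.zero    k           = refl
toℕ-punchIn (Fin.suc j) Fin.zero    = refl
toℕ-punchIn (Fin.suc j) (Fin.suc k) = cong suc (toℕ-punchIn j k)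

det-cong : ∀ n {M M′ : Fin n → Fin n → ℚ} → (∀ i j → M i j ≡ M′ i j) → det n M ≡ det n M′
det-cong zero    h = refl
det-cong (suc n) h = Σ-cong (suc n) (λ j →
  cong₂ (λ x y → sign (toℕ j) * (x * y)) (h Fin.zero j) (det-cong n (λ i k → h (Fin.suc i) (punchIn j k))))

det≡detℕ : ∀ n (M : Matrix) → det n (λ i j → M (toℕ i) (toℕ j)) ≡ detℕ n M
det≡detℕ zero    M = refl
det≡detℕ (suc n) M = Σ-as-∑ (suc n) _ (λ j → sign j * (M 0 j * detℕ n (minor j M))) (λ j →
  cong (λ z → sign (toℕ j) * (M 0 (toℕ j) * z))
       (trans (det-cong n (λ i k → cong (M (suc (toℕ i))) (toℕ-punchIn j k))) (det≡detℕ n (minor (toℕ j) M))))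

-- Polynomials as power series

coeff-+ₚ : ∀ p q e → coeff (p +ₚ q) e ≡ coeff p e + coeff q e
coeff-+ₚ []      q       e       = sym (+-identityˡ _)
coeff-+ₚ (a ∷ p) []      e       = sym (+-identityʳ _)
coeff-+ₚ (a ∷ p) (b ∷ q) zero    = refl
coeff-+ₚ (a ∷ p) (b ∷ q) (suc e) = coeff-+ₚ p q e

coeff-map-* : ∀ a q e → coeff (map (a *_) q) e ≡ a * coeff q e
coeff-map-* a []      e       = sym (*-zeroʳ a)
coeff-map-* a (b ∷ q) zero    = refl
coeff-map-* a (b ∷ q) (suc e) = coeff-map-* a q e

coeff-*ₚ : ∀ p q → coeff (p *ₚ q) ≗ coeff p ⋆ coeff q
coeff-*ₚ []      q e       = sym (⋆-zeroˡ (coeff []) (coeff q) (λ _ → refl) e)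
coeff-*ₚ (a ∷ p) q zero    =
  trans (coeff-+ₚ (map (a *_) q) (0ℚ ∷ (p *ₚ q)) 0) (trans (cong (_+ 0ℚ) (coeff-map-* a q 0)) (+-identityʳ _))
coeff-*ₚ (a ∷ p) q (suc e) =
  trans (coeff-+ₚ (map (a *_) q) (0ℚ ∷ (p *ₚ q)) (suc e)) (cong₂ _+_ (coeff-map-* a q (suc e)) (coeff-*ₚ p q e))

coeff-onePoly : coeff onePoly ≗ δ
coeff-onePoly zero    = refl
coeff-onePoly (suc e) = refl

coeff-xPow : ∀ m → coeff (xPow m) ≗ X^ m · δ
coeff-xPow zero    zero    = refl
coeff-xPow zero    (suc e) = refl
coeff-xPow (suc m) zero    = refl
coeff-xPow (suc m) (suc e) = coeff-xPow m e

coeff-x+1Pow : ∀ m → coeff (x+1Pow m) ≗ [1+X]^ m · δ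
coeff-x+1Pow zero    e = coeff-onePoly e
coeff-x+1Pow (suc m) e = begin
  coeff ((1ℚ ∷ 1ℚ ∷ []) *ₚ x+1Pow m) e
    ≡⟨ coeff-*ₚ (1ℚ ∷ 1ℚ ∷ []) (x+1Pow m) e ⟩
  (coeff (1ℚ ∷ 1ℚ ∷ []) ⋆ coeff (x+1Pow m)) e
    ≡⟨ ⋆-congˡ (coeff (x+1Pow m)) 1+X e ⟩
  ((δ ⊕ X· δ) ⋆ coeff (x+1Pow m)) e
    ≡⟨ ⋆-distribʳ-⊕ δ (X· δ) _ e ⟩
  (δ ⋆ coeff (x+1Pow m)) e + (X· δ ⋆ coeff (x+1Pow m)) e
    ≡⟨ cong₂ _+_ (⋆-identityˡ _ e) (trans (⋆-X·ˡ δ _ e) (X·-cong (⋆-identityˡ _) e)) ⟩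
  ([1+X]· coeff (x+1Pow m)) e
    ≡⟨ [1+X]·-cong (coeff-x+1Pow m) e ⟩
  ([1+X]^ suc m · δ) e ∎
  where
  1+X : coeff (1ℚ ∷ 1ℚ ∷ []) ≗ δ ⊕ X· δ
  1+X zero          = sym (+-identityʳ 1ℚ)
  1+X (suc zero)    = sym (+-identityˡ 1ℚ)
  1+X (suc (suc e)) = sym (+-identityˡ 0ℚ)

coeff-toList-≥ : ∀ {m} (v : Vec ℚ m) e → m ≤ e → coeff (toList v) e ≡ 0ℚ
coeff-toList-≥ Vec.[]       e       _         = refl
coeff-toList-≥ (x Vec.∷ v) (suc e) (s≤s m≤e) = coeff-toList-≥ v e m≤e

coeff-snoc : ∀ xs a → coeff (xs ++ a ∷ []) (length xs) ≡ a
coeff-snoc []       a = refl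
coeff-snoc (x ∷ xs) a = coeff-snoc xs a

deg-snoc : ∀ xs a → a ≢ 0ℚ → deg (xs ++ a ∷ []) ≡ length xs
deg-snoc xs a a≢0 = begin
  length (trim (xs ++ a ∷ [])) ∸ 1    ≡⟨ cong (λ z → length z ∸ 1) trim-snoc ⟩
  length (xs ++ a ∷ []) ∸ 1           ≡⟨ cong (_∸ 1) (Listₚ.length-++ xs) ⟩
  (length xs ℕ.+ 1) ∸ 1               ≡⟨ ℕₚ.m+n∸n≡m (length xs) 1 ⟩
  length xs                          ∎
  where
  dropZeros-nonzero : dropZeros (a ∷ reverse xs) ≡ a ∷ reverse xs
  dropZeros-nonzero with a ≟ 0ℚ
  ... | yes a≡0 = ⊥-elim (a≢0 a≡0)
  ... | no _    = refl
  trim-snoc : trim (xs ++ a ∷ []) ≡ xs ++ a ∷ []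
  trim-snoc = begin
    reverse (dropZeros (reverse (xs ++ a ∷ [])))
      ≡⟨ cong (λ z → reverse (dropZeros z)) (Listₚ.reverse-++ xs (a ∷ [])) ⟩
    reverse (dropZeros (a ∷ reverse xs))
      ≡⟨ cong reverse dropZeros-nonzero ⟩
    reverse (a ∷ reverse xs)
      ≡⟨ Listₚ.unfold-reverse a (reverse xs) ⟩
    reverse (reverse xs) ++ a ∷ []
      ≡⟨ cong (_++ a ∷ []) (Listₚ.reverse-involutive xs) ⟩
    xs ++ a ∷ [] ∎

deg-toList : ∀ n (v : Vec ℚ (suc n)) → coeff (toList v) n ≢ 0ℚ → deg (toList v) ≡ n
deg-toList n v lead≢0 with Vec.initLast v
... | ys , y , refl = begin
  deg (toList (ys Vec.∷ʳ y))     ≡⟨ cong deg (Vecₚ.toList-∷ʳ y ys) ⟩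
  deg (toList ys ++ y ∷ [])      ≡⟨ deg-snoc (toList ys) y y≢0 ⟩
  length (toList ys)             ≡⟨ Vecₚ.length-toList ys ⟩
  n                              ∎
  where
  lead≡y : coeff (toList (ys Vec.∷ʳ y)) n ≡ y
  lead≡y = trans (cong (λ l → coeff l n) (Vecₚ.toList-∷ʳ y ys))
                 (trans (cong (coeff (toList ys ++ y ∷ [])) (sym (Vecₚ.length-toList ys))) (coeff-snoc (toList ys) y))
  y≢0 : y ≢ 0ℚ
  y≢0 y≡0 = lead≢0 (trans lead≡y y≡0)

-- Sylvester matrices

sylvesterℕ : Poly → Poly → ℕ → ℕ → Matrix
sylvesterℕ f g a b r c = if ⌊ r ℕ.<? b ⌋ then shiftRow f a r c else shiftRow g b (r ∸ b) c

resultant≡detℕ : ∀ f g a b → deg f ≡ a → deg g ≡ b → resultant f g ≡ detℕ (a ℕ.+ b) (sylvesterℕ f g a b)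
resultant≡detℕ f g _ _ refl refl = det≡detℕ (deg f ℕ.+ deg g) (sylvesterℕ f g (deg f) (deg g))

sylvesterℕ-upper : ∀ f g a b r c → r < b → sylvesterℕ f g a b r c ≡ shiftRow f a r c
sylvesterℕ-upper f g a b r c r<b = if-yes (r ℕ.<? b) r<b

sylvesterℕ-lower : ∀ f g a b r c → ¬ r < b → sylvesterℕ f g a b r c ≡ shiftRow g b (r ∸ b) c
sylvesterℕ-lower f g a b r c r≮b = if-no (r ℕ.<? b) r≮b

shiftRow-as-X^· : ∀ (f : Poly) d r b c → c ≤ (r ℕ.+ b) ℕ.+ d → (∀ e → d < e → coeff f e ≡ 0ℚ) →
  shiftRow f d r c ≡ (X^ b · coeff f) (((r ℕ.+ b) ℕ.+ d) ∸ c)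
shiftRow-as-X^· f d r b c c≤ high with r ℕ.≤? c
... | no r≰c = sym (begin
  (X^ b · coeff f) ((r ℕ.+ b ℕ.+ d) ∸ c)
    ≡⟨ cong (X^ b · coeff f) (trans (cong (_∸ c) reassoc) (ℕₚ.+-∸-assoc b c≤r+d)) ⟩
  (X^ b · coeff f) (b ℕ.+ ((r ℕ.+ d) ∸ c))
    ≡⟨ X^·-+ b (coeff f) ((r ℕ.+ d) ∸ c) ⟩
  coeff f ((r ℕ.+ d) ∸ c)
    ≡⟨ high _ d<r+d∸c ⟩
  0ℚ ∎)
  where
  c<r : c < r
  c<r = ℕₚ.≰⇒> r≰c
  reassoc : r ℕ.+ b ℕ.+ d ≡ b ℕ.+ (r ℕ.+ d)
  reassoc = trans (cong (ℕ._+ d) (ℕₚ.+-comm r b)) (ℕₚ.+-assoc b r d)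
  c≤r+d : c ≤ r ℕ.+ d
  c≤r+d = ℕₚ.≤-trans (ℕₚ.<⇒≤ c<r) (ℕₚ.m≤m+n r d)
  d<r+d∸c : d < (r ℕ.+ d) ∸ c
  d<r+d∸c = subst (d <_) (sym (ℕₚ.+-∸-comm d (ℕₚ.<⇒≤ c<r))) (ℕₚ.m<n+m d (ℕₚ.m<n⇒0<n∸m c<r))
... | yes r≤c with (c ∸ r) ℕ.≤? d
...   | yes c∸r≤d = sym (trans (cong (X^ b · coeff f) reindex) (X^·-+ b (coeff f) ((d ℕ.+ r) ∸ c)))
  where
  c≤d+r : c ≤ d ℕ.+ r
  c≤d+r = subst (_≤ d ℕ.+ r) (ℕₚ.m∸n+n≡m r≤c) (ℕₚ.+-monoˡ-≤ r c∸r≤d)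
  reindex : (r ℕ.+ b ℕ.+ d) ∸ c ≡ b ℕ.+ ((d ℕ.+ r) ∸ c)
  reindex = trans (cong (_∸ c) (trans (cong (ℕ._+ d) (ℕₚ.+-comm r b))
                                     (trans (ℕₚ.+-assoc b r d) (cong (b ℕ.+_) (ℕₚ.+-comm r d)))))
                  (ℕₚ.+-∸-assoc b c≤d+r)
...   | no c∸r≰d = sym (X^·-< b (coeff f) _ below)
  where
  r+d<c : r ℕ.+ d < c
  r+d<c = subst (_≤ c) (cong suc (ℕₚ.+-comm d r))
                (subst (suc d ℕ.+ r ≤_) (ℕₚ.m∸n+n≡m r≤c) (ℕₚ.+-monoˡ-≤ r (ℕₚ.≰⇒> c∸r≰d)))
  reassoc : r ℕ.+ b ℕ.+ d ≡ b ℕ.+ (r ℕ.+ d)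
  reassoc = trans (cong (ℕ._+ d) (ℕₚ.+-comm r b)) (ℕₚ.+-assoc b r d)
  below : (r ℕ.+ b ℕ.+ d) ∸ c < b
  below = subst₂ (λ x y → x ∸ c < y) (sym reassoc) (ℕₚ.m+n∸n≡m b (r ℕ.+ d))
                 (ℕₚ.∸-monoʳ-< r+d<c (subst (c ≤_) reassoc c≤))

shiftRow-as-X^[L∸r]· : ∀ (f : Poly) d L r c → r ≤ L → c ≤ L ℕ.+ d → (∀ e → d < e → coeff f e ≡ 0ℚ) →
  shiftRow f d r c ≡ (X^ (L ∸ r) · coeff f) ((L ℕ.+ d) ∸ c)
shiftRow-as-X^[L∸r]· f d L r c r≤L c≤ high =
  trans (shiftRow-as-X^· f d r (L ∸ r) c (subst (λ z → c ≤ z ℕ.+ d) (sym r+[L∸r]≡L) c≤) high)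
        (cong (λ z → (X^ (L ∸ r) · coeff f) ((z ℕ.+ d) ∸ c)) r+[L∸r]≡L)
  where
  r+[L∸r]≡L : r ℕ.+ (L ∸ r) ≡ L
  r+[L∸r]≡L = ℕₚ.m+[n∸m]≡n r≤L

-- Binomial coefficients in ℚ

fromℕ : ℕ → ℚ
fromℕ k = (ℤ.+ k) / 1

fromℕ-suc : ∀ k → fromℕ (suc k) ≡ 1ℚ + fromℕ k
fromℕ-suc k = sym (toℚᵘ-injective (ℚᵘₚ.≃-trans (toℚᵘ-homo-+ 1ℚ (fromℕ k))
  (ℚᵘₚ.≃-trans (ℚᵘₚ.+-congʳ (toℚᵘ 1ℚ) (toℚᵘ-fromℚᵘ (ℚᵘ.mkℚᵘ (ℤ.+ k) 0)))
  (ℚᵘₚ.≃-trans (ℚᵘ.*≡* numerators) (ℚᵘₚ.≃-sym (toℚᵘ-fromℚᵘ (ℚᵘ.mkℚᵘ (ℤ.+ suc k) 0)))))))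
  where
  open ℤSolver.+-*-Solver renaming (solve to solveℤ; _:+_ to _:+ℤ_; _:*_ to _:*ℤ_; _:=_ to _:=ℤ_; con to conℤ)
  numerators : (ℤ.+ 1 ℤ.* ℤ.+ 1 ℤ.+ ℤ.+ k ℤ.* ℤ.+ 1) ℤ.* ℤ.+ 1 ≡ ℤ.+ suc k ℤ.* ℤ.+ 1
  numerators = solveℤ 1 (λ x → (conℤ (ℤ.+ 1) :*ℤ conℤ (ℤ.+ 1) :+ℤ x :*ℤ conℤ (ℤ.+ 1)) :*ℤ conℤ (ℤ.+ 1)
                              :=ℤ (conℤ (ℤ.+ 1) :+ℤ x) :*ℤ conℤ (ℤ.+ 1)) refl (ℤ.+ k)

fromℕ-+ : ∀ a b → fromℕ (a ℕ.+ b) ≡ fromℕ a + fromℕ b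
fromℕ-+ zero    b = sym (+-identityˡ (fromℕ b))
fromℕ-+ (suc a) b = begin
  fromℕ (suc (a ℕ.+ b))       ≡⟨ fromℕ-suc (a ℕ.+ b) ⟩
  1ℚ + fromℕ (a ℕ.+ b)        ≡⟨ cong (1ℚ +_) (fromℕ-+ a b) ⟩
  1ℚ + (fromℕ a + fromℕ b)    ≡⟨ sym (+-assoc 1ℚ (fromℕ a) (fromℕ b)) ⟩
  1ℚ + fromℕ a + fromℕ b      ≡⟨ cong (_+ fromℕ b) (sym (fromℕ-suc a)) ⟩
  fromℕ (suc a) + fromℕ b     ∎

fromℕ-* : ∀ a b → fromℕ (a ℕ.* b) ≡ fromℕ a * fromℕ b
fromℕ-* zero    b = sym (*-zeroˡ (fromℕ b))
fromℕ-* (suc a) b = begin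
  fromℕ (b ℕ.+ a ℕ.* b)         ≡⟨ fromℕ-+ b (a ℕ.* b) ⟩
  fromℕ b + fromℕ (a ℕ.* b)     ≡⟨ cong (fromℕ b +_) (fromℕ-* a b) ⟩
  fromℕ b + fromℕ a * fromℕ b   ≡⟨ solve 2 (λ x y → y :+ x :* y := (con 1ℚ :+ x) :* y) refl (fromℕ a) (fromℕ b) ⟩
  (1ℚ + fromℕ a) * fromℕ b      ≡⟨ cong (_* fromℕ b) (sym (fromℕ-suc a)) ⟩
  fromℕ (suc a) * fromℕ b       ∎

fromℕ-^ : ∀ a k → fromℕ (a ^ k) ≡ fromℕ a ^ℚ k
fromℕ-^ a zero    = refl
fromℕ-^ a (suc k) = trans (fromℕ-* a (a ^ k)) (cong (fromℕ a *_) (fromℕ-^ a k))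

fromℕ-nonZero : ∀ k → 0 < k → fromℕ k ≢ 0ℚ
fromℕ-nonZero (suc k) _ eq with ℚᵘₚ.≃-trans (ℚᵘₚ.≃-sym (toℚᵘ-fromℚᵘ (ℚᵘ.mkℚᵘ (ℤ.+ suc k) 0))) (toℚᵘ-cong eq)
... | ℚᵘ.*≡* ()

two four : ℚ
two  = fromℕ 2
four = fromℕ 4

sign-* : ∀ k → sign k * sign k ≡ 1ℚ
sign-* zero          = refl
sign-* (suc zero)    = refl
sign-* (suc (suc k)) = sign-* k

-1^≡sign : ∀ k → (- 1ℚ) ^ℚ k ≡ sign k
-1^≡sign zero    = refl
-1^≡sign (suc k) = trans (cong ((- 1ℚ) *_) (-1^≡sign k))
  (trans (solve 1 (λ x → (:- con 1ℚ) :* x := :- x) refl (sign k)) (sym (sign-suc k)))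

1^≡1 : ∀ k → 1ℚ ^ℚ k ≡ 1ℚ
1^≡1 zero    = refl
1^≡1 (suc k) = trans (cong (1ℚ *_) (1^≡1 k)) (*-identityˡ 1ℚ)

nCk>0 : ∀ {n k} → k ≤ n → 0 < n C k
nCk>0 {n}     {zero}  _         = s≤s z≤n
nCk>0 {suc n} {suc k} (s≤s k≤n) =
  subst (0 <_) (nCk+nC[k+1]≡[n+1]C[k+1] n k) (ℕₚ.<-≤-trans (nCk>0 k≤n) (ℕₚ.m≤m+n _ _))

C⁺ : ℕ → ℕ → ℚ
C⁺ n k = fromℕ ((n ℕ.+ k) C k)

C⁺-nonZero : ∀ n k → C⁺ n k ≢ 0ℚ
C⁺-nonZero n k = fromℕ-nonZero _ (nCk>0 (ℕₚ.m≤n+m k n))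

C⁺-pascal : ∀ n k → C⁺ (suc n) (suc k) ≡ C⁺ (suc n) k + C⁺ n (suc k)
C⁺-pascal n k = trans (cong fromℕ (sym (nCk+nC[k+1]≡[n+1]C[k+1] (n ℕ.+ suc k) k)))
  (trans (fromℕ-+ ((n ℕ.+ suc k) C k) ((n ℕ.+ suc k) C suc k))
         (cong (λ z → fromℕ (z C k) + C⁺ n (suc k)) (ℕₚ.+-suc n k)))

C⁺-recurrence : ∀ n → C⁺ (suc n) ≗ C⁺ n ⊕ X· C⁺ (suc n)
C⁺-recurrence n zero    = sym (+-identityʳ 1ℚ)
C⁺-recurrence n (suc k) = trans (C⁺-pascal n k) (+-comm (C⁺ (suc n) k) (C⁺ n (suc k)))

C⁺-symmetric : ∀ k → C⁺ (suc k) k ≡ C⁺ k (suc k)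
C⁺-symmetric k = cong fromℕ (trans (nCk≡nC[n∸k] (ℕₚ.m≤n+m k (suc k)))
                                    (cong₂ _C_ (sym (ℕₚ.+-suc k k)) 2k+1∸k≡k+1))
  where
  2k+1∸k≡k+1 : suc (k ℕ.+ k) ∸ k ≡ suc k
  2k+1∸k≡k+1 = trans (ℕₚ.+-∸-assoc 1 (ℕₚ.m≤n+m k k)) (cong suc (ℕₚ.m+n∸n≡m k k))

C⁺-diagonal : ∀ n → C⁺ (suc n) (suc n) ≡ two * C⁺ n (suc n)
C⁺-diagonal n = trans (C⁺-pascal n n) (trans (cong (_+ C⁺ n (suc n)) (C⁺-symmetric n))
  (solve 1 (λ x → x :+ x := (con 1ℚ :+ con 1ℚ) :* x) refl (C⁺ n (suc n))))

-- The coefficients of Qₙ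

-- The power series (1+x)^-(n+1); Qₙ is its truncation at degree n.
Qcoeff : ℕ → Series
Qcoeff n k = sign k * C⁺ n k

Qcoeff-nonZero : ∀ n k → Qcoeff n k ≢ 0ℚ
Qcoeff-nonZero n k eq = C⁺-nonZero n k (begin
  C⁺ n k                       ≡⟨ sym (*-identityˡ (C⁺ n k)) ⟩
  1ℚ * C⁺ n k                  ≡⟨ cong (_* C⁺ n k) (sym (sign-* k)) ⟩
  sign k * sign k * C⁺ n k     ≡⟨ *-assoc (sign k) (sign k) (C⁺ n k) ⟩
  sign k * Qcoeff n k          ≡⟨ cong (sign k *_) eq ⟩
  sign k * 0ℚ                  ≡⟨ *-zeroʳ (sign k) ⟩
  0ℚ                           ∎)

[1+X]·Qcoeff-suc : ∀ m → [1+X]· Qcoeff (suc m) ≗ Qcoeff m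
[1+X]·Qcoeff-suc m zero    = +-identityʳ _
[1+X]·Qcoeff-suc m (suc e) = begin
  sign (suc e) * C⁺ (suc m) (suc e) + sign e * C⁺ (suc m) e
    ≡⟨ cong₂ (λ x y → x * y + sign e * C⁺ (suc m) e) (sign-suc e) (C⁺-pascal m e) ⟩
  (- sign e) * (C⁺ (suc m) e + C⁺ m (suc e)) + sign e * C⁺ (suc m) e
    ≡⟨ solve 3 (λ σ a b → (:- σ) :* (a :+ b) :+ σ :* a := (:- σ) :* b) refl (sign e) (C⁺ (suc m) e) (C⁺ m (suc e)) ⟩
  (- sign e) * C⁺ m (suc e)
    ≡⟨ cong (_* C⁺ m (suc e)) (sym (sign-suc e)) ⟩
  Qcoeff m (suc e) ∎

[1+X]·Qcoeff-zero : [1+X]· Qcoeff 0 ≗ δ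
[1+X]·Qcoeff-zero zero    = +-identityʳ _
[1+X]·Qcoeff-zero (suc e) = begin
  sign (suc e) * C⁺ 0 (suc e) + sign e * C⁺ 0 e
    ≡⟨ cong₂ (λ x y → x * fromℕ y + sign e * fromℕ (e C e)) (sign-suc e) (nCn≡1 (suc e)) ⟩
  (- sign e) * 1ℚ + sign e * fromℕ (e C e)
    ≡⟨ cong (λ z → (- sign e) * 1ℚ + sign e * fromℕ z) (nCn≡1 e) ⟩
  (- sign e) * 1ℚ + sign e * 1ℚ
    ≡⟨ solve 1 (λ σ → (:- σ) :* con 1ℚ :+ σ :* con 1ℚ := con 0ℚ) refl (sign e) ⟩
  0ℚ ∎

[1+X]^·Qcoeff : ∀ k m → [1+X]^ k · Qcoeff (k ℕ.+ m) ≗ Qcoeff m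
[1+X]^·Qcoeff zero    m e = refl
[1+X]^·Qcoeff (suc k) m e = trans (sym (commute k (Qcoeff (suc k ℕ.+ m)) e))
  (trans ([1+X]^·-cong k ([1+X]·Qcoeff-suc (k ℕ.+ m)) e) ([1+X]^·Qcoeff k m e))
  where
  commute : ∀ k a → [1+X]^ k · [1+X]· a ≗ [1+X]^ suc k · a
  commute zero    a = λ _ → refl
  commute (suc k) a = [1+X]·-cong (commute k a)

[1+X]^·Qcoeff≗δ : ∀ n → [1+X]^ suc n · Qcoeff n ≗ δ
[1+X]^·Qcoeff≗δ n e = trans
  ([1+X]·-cong (λ e′ → trans ([1+X]^·-cong n (λ x → cong (λ z → Qcoeff z x) (sym (ℕₚ.+-identityʳ n))) e′)
                             ([1+X]^·Qcoeff n 0 e′)) e)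
  ([1+X]·Qcoeff-zero e)

[1+X]·-injective-≤ : ∀ K a b → (∀ e → e ≤ K → ([1+X]· a) e ≡ ([1+X]· b) e) → ∀ e → e ≤ K → a e ≡ b e
[1+X]·-injective-≤ K a b h zero    0≤K  = trans (sym (+-identityʳ (a 0))) (trans (h 0 0≤K) (+-identityʳ (b 0)))
[1+X]·-injective-≤ K a b h (suc e) e+1≤K = begin
  a (suc e)
    ≡⟨ solve 2 (λ p q → p := (p :+ q) :+ (:- q)) refl (a (suc e)) (a e) ⟩
  a (suc e) + a e + (- a e)
    ≡⟨ cong₂ (λ u v → u + (- v)) (h (suc e) e+1≤K) ([1+X]·-injective-≤ K a b h e (ℕₚ.<⇒≤ e+1≤K)) ⟩
  b (suc e) + b e + (- b e)
    ≡⟨ solve 2 (λ p q → (p :+ q) :+ (:- q) := p) refl (b (suc e)) (b e) ⟩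
  b (suc e) ∎

[1+X]^·-injective-≤ : ∀ m K a b → (∀ e → e ≤ K → ([1+X]^ m · a) e ≡ ([1+X]^ m · b) e) → ∀ e → e ≤ K → a e ≡ b e
[1+X]^·-injective-≤ zero    K a b h = h
[1+X]^·-injective-≤ (suc m) K a b h =
  [1+X]^·-injective-≤ m K a b ([1+X]·-injective-≤ K ([1+X]^ m · a) ([1+X]^ m · b) h)

BezoutIdentity : ∀ n → Vec ℚ n → Vec ℚ n → Set
BezoutIdentity n P Q = ((toList P *ₚ xPow n) +ₚ (toList Q *ₚ x+1Pow n)) ≈ₚ onePoly

bezout⇒coeff : ∀ n (P Q : Vec ℚ (suc n)) → BezoutIdentity (suc n) P Q → ∀ e → e ≤ n → coeff (toList Q) e ≡ Qcoeff n e
bezout⇒coeff n P Q bezout = [1+X]^·-injective-≤ (suc n) n (coeff (toList Q)) (Qcoeff n) agree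
  where
  p q : Poly
  p = toList P
  q = toList Q
  agree : ∀ e → e ≤ n → ([1+X]^ suc n · coeff q) e ≡ ([1+X]^ suc n · Qcoeff n) e
  agree e e≤n = begin
    ([1+X]^ suc n · coeff q) e
      ≡⟨ sym (+-identityˡ _) ⟩
    0ℚ + ([1+X]^ suc n · coeff q) e
      ≡⟨ cong₂ _+_ (sym lowP) (sym lowQ) ⟩
    coeff (p *ₚ xPow (suc n)) e + coeff (q *ₚ x+1Pow (suc n)) e
      ≡⟨ sym (coeff-+ₚ (p *ₚ xPow (suc n)) (q *ₚ x+1Pow (suc n)) e) ⟩
    coeff ((p *ₚ xPow (suc n)) +ₚ (q *ₚ x+1Pow (suc n))) e
      ≡⟨ bezout e ⟩
    coeff onePoly e
      ≡⟨ coeff-onePoly e ⟩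
    δ e
      ≡⟨ sym ([1+X]^·Qcoeff≗δ n e) ⟩
    ([1+X]^ suc n · Qcoeff n) e ∎
    where
    lowP : coeff (p *ₚ xPow (suc n)) e ≡ 0ℚ
    lowP = trans (coeff-*ₚ p (xPow (suc n)) e) (trans (⋆-congʳ (coeff p) (coeff-xPow (suc n)) e)
                 (trans (⋆-X^·ʳ (suc n) (coeff p) δ e) (X^·-< (suc n) _ e (s≤s e≤n))))
    lowQ : coeff (q *ₚ x+1Pow (suc n)) e ≡ ([1+X]^ suc n · coeff q) e
    lowQ = trans (coeff-*ₚ q (x+1Pow (suc n)) e) (trans (⋆-congʳ (coeff q) (coeff-x+1Pow (suc n)) e)
                 (trans (⋆-[1+X]^ʳ (suc n) (coeff q) δ e) ([1+X]^·-cong (suc n) (⋆-identityʳ (coeff q)) e)))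

-- Inverses and geometric series

-- For F 0 = 1, inverseUpTo F m holds the coefficients of degree ≤ m of 1/F: each new
-- coefficient is determined by the lower ones.
inverseUpTo : Series → ℕ → Series
inverseUpTo F zero    i = δ i
inverseUpTo F (suc m) i with i ℕ.≤? m
... | yes _ = inverseUpTo F m i
... | no  _ = - (tail F ⋆ inverseUpTo F m) m

inverse : Series → Series
inverse F e = inverseUpTo F e e

inverseUpTo-top : ∀ F m → inverseUpTo F (suc m) (suc m) ≡ - (tail F ⋆ inverseUpTo F m) m
inverseUpTo-top F m with suc m ℕ.≤? m
... | yes m+1≤m = ⊥-elim (ℕₚ.<-irrefl refl m+1≤m)
... | no _      = refl

inverseUpTo-stable : ∀ F m i → i ≤ m → inverseUpTo F m i ≡ inverse F i
inverseUpTo-stable F zero    zero _ = refl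
inverseUpTo-stable F (suc m) i i≤m+1 with i ℕ.≤? m
... | yes i≤m = inverseUpTo-stable F m i i≤m
... | no  i≰m with ℕₚ.≤-antisym i≤m+1 (ℕₚ.≰⇒> i≰m)
...   | refl = sym (inverseUpTo-top F m)

⋆-inverseʳ : ∀ F → F 0 ≡ 1ℚ → F ⋆ inverse F ≗ δ
⋆-inverseʳ F F₀ zero    = trans (cong (_* 1ℚ) F₀) (*-identityˡ 1ℚ)
⋆-inverseʳ F F₀ (suc m) = begin
  F 0 * inverse F (suc m) + (tail F ⋆ inverse F) m
    ≡⟨ cong₂ (λ x y → x * y + (tail F ⋆ inverse F) m) F₀ next ⟩
  1ℚ * (- (tail F ⋆ inverse F) m) + (tail F ⋆ inverse F) m
    ≡⟨ solve 1 (λ x → con 1ℚ :* (:- x) :+ x := con 0ℚ) refl ((tail F ⋆ inverse F) m) ⟩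
  0ℚ ∎
  where
  next : inverse F (suc m) ≡ - (tail F ⋆ inverse F) m
  next = trans (inverseUpTo-top F m) (cong -_ (⋆-congʳ-≤ m (tail F) (inverseUpTo-stable F m)))

signed : Series → Series
signed a e = sign e * a e

⋆-signed : ∀ a b → signed a ⋆ signed b ≗ signed (a ⋆ b)
⋆-signed a b zero    = solve 2 (λ x y → (con 1ℚ :* x) :* (con 1ℚ :* y) := con 1ℚ :* (x :* y)) refl (a 0) (b 0)
⋆-signed a b (suc e) = begin
  (1ℚ * a 0) * (sign (suc e) * b (suc e)) + (tail (signed a) ⋆ signed b) e
    ≡⟨ cong₂ (λ σ z → (1ℚ * a 0) * (σ * b (suc e)) + z) (sign-suc e) (trans (⋆-congˡ (signed b) tail-signed e)
         (trans (⋆-•ˡ (- 1ℚ) (signed (tail a)) (signed b) e) (cong ((- 1ℚ) *_) (⋆-signed (tail a) b e)))) ⟩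
  (1ℚ * a 0) * ((- sign e) * b (suc e)) + (- 1ℚ) * (sign e * (tail a ⋆ b) e)
    ≡⟨ solve 4 (λ x s y c → (con 1ℚ :* x) :* ((:- s) :* y) :+ (:- con 1ℚ) :* (s :* c) := (:- s) :* (x :* y :+ c))
       refl (a 0) (sign e) (b (suc e)) ((tail a ⋆ b) e) ⟩
  (- sign e) * (a 0 * b (suc e) + (tail a ⋆ b) e)
    ≡⟨ cong (_* (a 0 * b (suc e) + (tail a ⋆ b) e)) (sym (sign-suc e)) ⟩
  signed (a ⋆ b) (suc e) ∎
  where
  tail-signed : tail (signed a) ≗ (- 1ℚ) • signed (tail a)
  tail-signed i = trans (cong (_* a (suc i)) (sign-suc i))
                        (solve 2 (λ s x → (:- s) :* x := (:- con 1ℚ) :* (s :* x)) refl (sign i) (a (suc i)))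

geometric : ℚ → Series
geometric r e = r ^ℚ e

geometric-neg : ∀ r → geometric (- r) ≗ signed (geometric r)
geometric-neg r e = begin
  (- r) ^ℚ e               ≡⟨ cong (_^ℚ e) (solve 1 (λ w → :- w := (:- con 1ℚ) :* w) refl r) ⟩
  ((- 1ℚ) * r) ^ℚ e        ≡⟨ ^-distrib-* (- 1ℚ) r e ⟩
  (- 1ℚ) ^ℚ e * r ^ℚ e     ≡⟨ cong (_* r ^ℚ e) (-1^≡sign e) ⟩
  sign e * r ^ℚ e          ∎

⋆-geometric-suc : ∀ r a e → (a ⋆ geometric r) (suc e) ≡ a (suc e) + r * (a ⋆ geometric r) e
⋆-geometric-suc r a e = trans (⋆-comm a (geometric r) (suc e))
  (cong₂ _+_ (*-identityˡ (a (suc e))) (trans (⋆-•ˡ r (geometric r) a e) (cong (r *_) (⋆-comm (geometric r) a e))))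

1+rX : ℚ → Series
1+rX r = δ ⊕ r • X· δ

geometric-inverse : ∀ r → geometric (- r) ⋆ 1+rX r ≗ δ
geometric-inverse r e = begin
  (geometric (- r) ⋆ (δ ⊕ r • X· δ)) e
    ≡⟨ ⋆-distribˡ-⊕ (geometric (- r)) δ (r • X· δ) e ⟩
  (geometric (- r) ⋆ δ) e + (geometric (- r) ⋆ (r • X· δ)) e
    ≡⟨ cong₂ _+_ (⋆-identityʳ _ e) (trans (⋆-•ʳ r _ (X· δ) e) (cong (r *_)
       (trans (⋆-X·ʳ _ δ e) (X·-cong (⋆-identityʳ _) e)))) ⟩
  geometric (- r) e + r * (X· geometric (- r)) e
    ≡⟨ telescope e ⟩
  δ e ∎
  where
  telescope : ∀ e → geometric (- r) e + r * (X· geometric (- r)) e ≡ δ e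
  telescope zero    = trans (cong (1ℚ +_) (*-zeroʳ r)) (+-identityʳ 1ℚ)
  telescope (suc e) = solve 2 (λ w x → (:- w) :* x :+ w :* x := con 0ℚ) refl r ((- r) ^ℚ e)

centralBinomialSum : ∀ n → (C⁺ n ⋆ geometric two) n ≡ four ^ℚ n
centralBinomialSum zero    = refl
centralBinomialSum (suc n) = begin
  T′
    ≡⟨ solve 1 (λ t → t := con two :* t :+ (:- t)) refl T′ ⟩
  two * T′ + (- T′)
    ≡⟨ cong₂ (λ x y → two * x + (- y)) viaRecurrence viaDiagonal ⟩
  two * (x + two * T + U) + (- (two * x + two * U))
    ≡⟨ solve 3 (λ x t u → con two :* (x :+ con two :* t :+ u) :+ (:- (con two :* x :+ con two :* u)) := con four :* t)
       refl x T U ⟩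
  four * T
    ≡⟨ cong (four *_) (centralBinomialSum n) ⟩
  four ^ℚ suc n ∎
  where
  g : Series
  g = geometric two
  T′ T U x : ℚ
  T′ = (C⁺ (suc n) ⋆ g) (suc n)
  T  = (C⁺ n ⋆ g) n
  U  = (C⁺ (suc n) ⋆ g) n
  x  = C⁺ n (suc n)
  viaRecurrence : T′ ≡ x + two * T + U
  viaRecurrence = begin
    T′
      ≡⟨ ⋆-congˡ g (C⁺-recurrence n) (suc n) ⟩
    ((C⁺ n ⊕ X· C⁺ (suc n)) ⋆ g) (suc n)
      ≡⟨ ⋆-distribʳ-⊕ (C⁺ n) (X· C⁺ (suc n)) g (suc n) ⟩
    (C⁺ n ⋆ g) (suc n) + (X· C⁺ (suc n) ⋆ g) (suc n)
      ≡⟨ cong₂ _+_ (⋆-geometric-suc two (C⁺ n) n) (⋆-X·ˡ (C⁺ (suc n)) g (suc n)) ⟩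
    x + two * T + U ∎
  viaDiagonal : T′ ≡ two * x + two * U
  viaDiagonal = trans (⋆-geometric-suc two (C⁺ (suc n)) n) (cong (_+ two * U) (C⁺-diagonal n))

four*-injective : ∀ a b → four * a ≡ four * b → a ≡ b
four*-injective a b eq = begin
  a                  ≡⟨ solve 1 (λ x → x := con (½ * ½) :* (con four :* x)) refl a ⟩
  ½ * ½ * (four * a) ≡⟨ cong (½ * ½ *_) eq ⟩
  ½ * ½ * (four * b) ≡⟨ solve 1 (λ x → con (½ * ½) :* (con four :* x) := x) refl b ⟩
  b                  ∎

nearCentralBinomialSum : ∀ m → (C⁺ (2 ℕ.+ m) ⋆ geometric two) m + C⁺ (suc m) (2 ℕ.+ m) ≡ four ^ℚ suc m
nearCentralBinomialSum m = four*-injective (V + Y) (four ^ℚ suc m) (begin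
  four * (V + Y)
    ≡⟨ solve 2 (λ v y → con four :* (v :+ y) := con two :* y :+ con two :* (y :+ con two :* v)) refl V Y ⟩
  two * Y + two * (Y + two * V)
    ≡⟨ cong₂ (λ a b → a + two * (b + two * V)) (sym (C⁺-diagonal (suc m))) (sym (C⁺-symmetric (suc m))) ⟩
  C⁺ n n + two * (C⁺ n (suc m) + two * V)
    ≡⟨ sym (trans (⋆-geometric-suc two (C⁺ n) (suc m)) (cong (λ z → C⁺ n n + two * z) (⋆-geometric-suc two (C⁺ n) m))) ⟩
  (C⁺ n ⋆ geometric two) n
    ≡⟨ centralBinomialSum n ⟩
  four ^ℚ n ∎)
  where
  n : ℕ
  n = 2 ℕ.+ m
  V Y : ℚ
  V = (C⁺ n ⋆ geometric two) m
  Y = C⁺ (suc m) n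

closedForm : ∀ k (W₀ Y : ℚ) → W₀ + sign k * Y ≡ sign k * four ^ℚ suc k →
  sign k ^ℚ suc k * (sign k * (- (sign k * Y)) ^ℚ k * (W₀ + sign k * Y)) ≡ two ^ℚ (2 ℕ.+ k) * (two * Y) ^ℚ k
closedForm k W₀ Y identity = begin
  σ ^ℚ suc k * (σ * (- (σ * Y)) ^ℚ k * (W₀ + σ * Y))
    ≡⟨ cong₂ (λ x y → σ ^ℚ suc k * (σ * x * y)) negativePower identity ⟩
  σ * σᵏ * (σ * (σ * (σᵏ * Yᵏ)) * (σ * (four * fourᵏ)))
    ≡⟨ solve 5 (λ s p y q f → s :* p :* (s :* (s :* (p :* y)) :* (s :* (q :* f)))
       := s :* s :* (s :* s) :* (p :* p) :* (y :* (q :* f))) refl σ σᵏ Yᵏ four fourᵏ ⟩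
  σ * σ * (σ * σ) * (σᵏ * σᵏ) * (Yᵏ * (four * fourᵏ))
    ≡⟨ cong₂ (λ x y → x * x * y * (Yᵏ * (four * fourᵏ))) (sign-* k) σᵏσᵏ≡1 ⟩
  1ℚ * 1ℚ * 1ℚ * (Yᵏ * (four * fourᵏ))
    ≡⟨ cong (λ z → 1ℚ * 1ℚ * 1ℚ * (Yᵏ * (four * z))) (^-distrib-* two two k) ⟩
  1ℚ * 1ℚ * 1ℚ * (Yᵏ * (four * (2ᵏ * 2ᵏ)))
    ≡⟨ solve 2 (λ y p → con 1ℚ :* con 1ℚ :* con 1ℚ :* (y :* (con four :* (p :* p)))
       := con two :* (con two :* p) :* (p :* y)) refl Yᵏ 2ᵏ ⟩
  two * (two * 2ᵏ) * (2ᵏ * Yᵏ)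
    ≡⟨ cong (two * (two * 2ᵏ) *_) (sym (^-distrib-* two Y k)) ⟩
  two ^ℚ (2 ℕ.+ k) * (two * Y) ^ℚ k ∎
  where
  σ σᵏ Yᵏ 2ᵏ fourᵏ : ℚ
  σ     = sign k
  σᵏ    = σ ^ℚ k
  Yᵏ    = Y ^ℚ k
  2ᵏ    = two ^ℚ k
  fourᵏ = four ^ℚ k
  negativePower : (- (σ * Y)) ^ℚ k ≡ σ * (σᵏ * Yᵏ)
  negativePower = begin
    (- (σ * Y)) ^ℚ k                ≡⟨ cong (_^ℚ k) (solve 1 (λ x → :- x := (:- con 1ℚ) :* x) refl (σ * Y)) ⟩
    ((- 1ℚ) * (σ * Y)) ^ℚ k         ≡⟨ ^-distrib-* (- 1ℚ) (σ * Y) k ⟩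
    (- 1ℚ) ^ℚ k * (σ * Y) ^ℚ k      ≡⟨ cong₂ _*_ (-1^≡sign k) (^-distrib-* σ Y k) ⟩
    σ * (σᵏ * Yᵏ)                   ∎
  σᵏσᵏ≡1 : σᵏ * σᵏ ≡ 1ℚ
  σᵏσᵏ≡1 = trans (sym (^-distrib-* σ σ k)) (trans (cong (_^ℚ k) (sign-* k)) (1^≡1 k))

-- The Sylvester determinant of Qₙ and Qₙ₋₁

module SylvesterDeterminant (m′ : ℕ) (f g : Poly)
  (F≤ : ∀ e → e ≤ suc (suc m′) → coeff f e ≡ Qcoeff (suc (suc m′)) e)
  (F> : ∀ e → suc (suc m′) < e → coeff f e ≡ 0ℚ)
  (G≤ : ∀ e → e ≤ suc m′ → coeff g e ≡ Qcoeff (suc m′) e)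
  (G> : ∀ e → suc m′ < e → coeff g e ≡ 0ℚ) where

  m n D : ℕ
  m = suc m′
  n = suc m
  D = m ℕ.+ m

  -- H = G/F, W = F/(1+2x), and h is the correction term in (1+x) F = G + xⁿ h.
  F G u H W : Series
  F = coeff f
  G = coeff g
  u = inverse F
  H = u ⋆ G
  W = F ⋆ geometric (- two)

  d : ℚ
  d = Qcoeff m n

  h R : Series
  h = d • 1+rX two
  R = u ⋆ h

  F₀ : F 0 ≡ 1ℚ
  F₀ = F≤ 0 z≤n

  u⋆F : u ⋆ F ≗ δ
  u⋆F e = trans (⋆-comm u F e) (⋆-inverseʳ F F₀ e)

  rowSeries : ℕ → Series
  rowSeries r = if ⌊ r ℕ.<? m ⌋ then X^ (m′ ∸ r) · F else X^ (m ∸ (r ∸ m)) · G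

  rowSeries-upper : ∀ r → r < m → rowSeries r ≡ X^ (m′ ∸ r) · F
  rowSeries-upper r r<m = if-yes (r ℕ.<? m) r<m

  rowSeries-lower : ∀ r → ¬ r < m → rowSeries r ≡ X^ (m ∸ (r ∸ m)) · G
  rowSeries-lower r r≮m = if-no (r ℕ.<? m) r≮m

  sylvester≡rowSeries : detℕ (n ℕ.+ m) (sylvesterℕ f g n m) ≡ detℕ (suc D) (λ r c → rowSeries r (D ∸ c))
  sylvester≡rowSeries = detℕ-cong (suc D) entry
    where
    m′+n≡D : m′ ℕ.+ n ≡ D
    m′+n≡D = ℕₚ.+-suc m′ m
    entry : ∀ r c → r < suc D → c < suc D → sylvesterℕ f g n m r c ≡ rowSeries r (D ∸ c)
    entry r c r≤D (s≤s c≤D) = byBlock (r ℕ.<? m)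
      where
      byBlock : Dec (r < m) → sylvesterℕ f g n m r c ≡ rowSeries r (D ∸ c)
      byBlock (yes r<m) = begin
        sylvesterℕ f g n m r c
          ≡⟨ sylvesterℕ-upper f g n m r c r<m ⟩
        shiftRow f n r c
          ≡⟨ shiftRow-as-X^[L∸r]· f n m′ r c (ℕₚ.≤-pred r<m) (subst (c ≤_) (sym m′+n≡D) c≤D) F> ⟩
        (X^ (m′ ∸ r) · F) ((m′ ℕ.+ n) ∸ c)
          ≡⟨ cong (λ z → (X^ (m′ ∸ r) · F) (z ∸ c)) m′+n≡D ⟩
        (X^ (m′ ∸ r) · F) (D ∸ c)
          ≡⟨ cong (λ s → s (D ∸ c)) (sym (rowSeries-upper r r<m)) ⟩
        rowSeries r (D ∸ c) ∎
      byBlock (no r≮m) = begin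
        sylvesterℕ f g n m r c                ≡⟨ sylvesterℕ-lower f g n m r c r≮m ⟩
        shiftRow g m (r ∸ m) c                 ≡⟨ shiftRow-as-X^[L∸r]· g m m (r ∸ m) c r∸m≤m c≤D G> ⟩
        (X^ (m ∸ (r ∸ m)) · G) (D ∸ c)         ≡⟨ cong (λ s → s (D ∸ c)) (sym (rowSeries-lower r r≮m)) ⟩
        rowSeries r (D ∸ c)                    ∎
        where
        r∸m≤m : r ∸ m ≤ m
        r∸m≤m = ℕₚ.≤-trans (ℕₚ.∸-monoˡ-≤ m (ℕₚ.≤-pred r≤D)) (ℕₚ.≤-reflexive (ℕₚ.m+n∸m≡n m m))

  S : Matrix
  S r c = (u ⋆ rowSeries r) (D ∸ c)

  S-upper : ∀ r c → r < m → S r c ≡ (X^ (m′ ∸ r) · δ) (D ∸ c)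
  S-upper r c r<m = trans (cong (λ z → (u ⋆ z) (D ∸ c)) (rowSeries-upper r r<m))
    (trans (⋆-X^·ʳ (m′ ∸ r) u F (D ∸ c)) (X^·-cong (m′ ∸ r) u⋆F (D ∸ c)))

  peelUnitRows : detℕ (suc D) S ≡ sign n ^ℚ m * detℕ n (λ i → S (m ℕ.+ i))
  peelUnitRows = trans (cong (λ z → detℕ z S) (sym m+n≡D+1)) (detℕ-unitRows m n S unit off)
    where
    m+n≡D+1 : m ℕ.+ n ≡ suc D
    m+n≡D+1 = cong suc (ℕₚ.+-suc m′ m)
    D≡n+r+[m′∸r] : ∀ r → r ≤ m′ → D ≡ (n ℕ.+ r) ℕ.+ (m′ ∸ r)
    D≡n+r+[m′∸r] r r≤m′ = trans (ℕₚ.+-suc m m′)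
      (trans (cong (n ℕ.+_) (sym (ℕₚ.m+[n∸m]≡n r≤m′))) (sym (ℕₚ.+-assoc n r (m′ ∸ r))))
    unit : ∀ r → r < m → S r (n ℕ.+ r) ≡ 1ℚ
    unit r r<m = trans (S-upper r (n ℕ.+ r) r<m)
      (trans (cong (X^ (m′ ∸ r) · δ) (trans (cong (_∸ (n ℕ.+ r)) (D≡n+r+[m′∸r] r (ℕₚ.≤-pred r<m)))
                                            (ℕₚ.m+n∸m≡n (n ℕ.+ r) (m′ ∸ r))))
             (X^·δ-diag (m′ ∸ r)))
    off : ∀ r c → r < m → c < m ℕ.+ n → c ≢ n ℕ.+ r → S r c ≡ 0ℚ
    off r c r<m c< c≢n+r = trans (S-upper r c r<m) (X^·δ-off (m′ ∸ r) (D ∸ c) D∸c≢m′∸r)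
      where
      c≤D : c ≤ D
      c≤D = ℕₚ.≤-pred (subst (c <_) m+n≡D+1 c<)
      D∸c≢m′∸r : D ∸ c ≢ m′ ∸ r
      D∸c≢m′∸r eq = c≢n+r (begin
        c                              ≡⟨ sym (ℕₚ.m∸[m∸n]≡n c≤D) ⟩
        D ∸ (D ∸ c)                    ≡⟨ cong (D ∸_) eq ⟩
        D ∸ (m′ ∸ r)                   ≡⟨ cong (_∸ (m′ ∸ r)) (D≡n+r+[m′∸r] r (ℕₚ.≤-pred r<m)) ⟩
        n ℕ.+ r ℕ.+ (m′ ∸ r) ∸ (m′ ∸ r) ≡⟨ ℕₚ.m+n∸n≡m (n ℕ.+ r) (m′ ∸ r) ⟩
        n ℕ.+ r                        ∎)

  lowerRows≡H : detℕ n (λ i → S (m ℕ.+ i)) ≡ detℕ n (λ i k → H (i ℕ.+ (m ∸ k)))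
  lowerRows≡H = detℕ-cong n entry
    where
    entry : ∀ i k → i < n → k < n → S (m ℕ.+ i) k ≡ H (i ℕ.+ (m ∸ k))
    entry i k (s≤s i≤m) (s≤s k≤m) = begin
      (u ⋆ rowSeries (m ℕ.+ i)) (D ∸ k)          ≡⟨ cong (λ z → (u ⋆ z) (D ∸ k)) lowerRow ⟩
      (u ⋆ X^ (m ∸ i) · G) (D ∸ k)               ≡⟨ ⋆-X^·ʳ (m ∸ i) u G (D ∸ k) ⟩
      (X^ (m ∸ i) · H) (D ∸ k)                   ≡⟨ cong (X^ (m ∸ i) · H) (sym split) ⟩
      (X^ (m ∸ i) · H) ((m ∸ i) ℕ.+ (i ℕ.+ (m ∸ k))) ≡⟨ X^·-+ (m ∸ i) H (i ℕ.+ (m ∸ k)) ⟩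
      H (i ℕ.+ (m ∸ k))                          ∎
      where
      lowerRow : rowSeries (m ℕ.+ i) ≡ X^ (m ∸ i) · G
      lowerRow = trans (rowSeries-lower (m ℕ.+ i) (λ m+i<m → ℕₚ.<-irrefl refl (ℕₚ.<-≤-trans m+i<m (ℕₚ.m≤m+n m i))))
                       (cong (λ z → X^ (m ∸ z) · G) (ℕₚ.m+n∸m≡n m i))
      split : (m ∸ i) ℕ.+ (i ℕ.+ (m ∸ k)) ≡ D ∸ k
      split = trans (sym (ℕₚ.+-assoc (m ∸ i) i (m ∸ k)))
                    (trans (cong (ℕ._+ (m ∸ k)) (ℕₚ.m∸n+n≡m i≤m)) (sym (ℕₚ.+-∸-assoc m k≤m)))

  X·F≤ : ∀ e → e ≤ n → (X· F) e ≡ (X· Qcoeff n) e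
  X·F≤ zero    _   = refl
  X·F≤ (suc e) e<n = F≤ e (ℕₚ.m≤n⇒m≤1+n (ℕₚ.≤-pred e<n))

  [1+X]F≗G⊕Xⁿh-low : ∀ e → e ≤ m → ([1+X]· F) e ≡ (G ⊕ X^ n · h) e
  [1+X]F≗G⊕Xⁿh-low e e≤m = begin
    ([1+X]· F) e                 ≡⟨ cong₂ _+_ (F≤ e (ℕₚ.m≤n⇒m≤1+n e≤m)) (X·F≤ e (ℕₚ.m≤n⇒m≤1+n e≤m)) ⟩
    ([1+X]· Qcoeff n) e          ≡⟨ [1+X]·Qcoeff-suc m e ⟩
    Qcoeff m e                   ≡⟨ sym (G≤ e e≤m) ⟩
    G e                          ≡⟨ sym (+-identityʳ (G e)) ⟩
    G e + 0ℚ                     ≡⟨ cong (G e +_) (sym (X^·-< n h e (s≤s e≤m))) ⟩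
    (G ⊕ X^ n · h) e             ∎

  [1+X]F≗G⊕Xⁿh-high : ∀ t → ([1+X]· F) (t ℕ.+ n) ≡ (G ⊕ X^ n · h) (t ℕ.+ n)
  [1+X]F≗G⊕Xⁿh-high zero = begin
    F n + F m                    ≡⟨ cong₂ _+_ (F≤ n ℕₚ.≤-refl) (F≤ m (ℕₚ.n≤1+n m)) ⟩
    Qcoeff n n + Qcoeff n m      ≡⟨ [1+X]·Qcoeff-suc m n ⟩
    d                            ≡⟨ solve 2 (λ d w → d := con 0ℚ :+ d :* (con 1ℚ :+ w :* con 0ℚ)) refl d two ⟩
    0ℚ + h 0                     ≡⟨ sym (cong₂ _+_ (G> n (ℕₚ.n<1+n m)) (X^·-+ʳ n h 0)) ⟩
    G n + (X^ n · h) n           ∎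
  [1+X]F≗G⊕Xⁿh-high (suc zero) = begin
    F (suc n) + F n
      ≡⟨ cong₂ _+_ (F> (suc n) (ℕₚ.n<1+n n)) (F≤ n ℕₚ.≤-refl) ⟩
    0ℚ + Qcoeff n n
      ≡⟨ cong (λ z → 0ℚ + sign n * z) (C⁺-diagonal m) ⟩
    0ℚ + sign n * (two * C⁺ m n)
      ≡⟨ solve 3 (λ σ w y → con 0ℚ :+ σ :* (w :* y) := con 0ℚ :+ (σ :* y) :* (con 0ℚ :+ w :* con 1ℚ))
         refl (sign n) two (C⁺ m n) ⟩
    0ℚ + h 1
      ≡⟨ sym (cong₂ _+_ (G> (suc n) (ℕₚ.≤-trans (ℕₚ.n<1+n m) (ℕₚ.n≤1+n n))) (X^·-+ʳ n h 1)) ⟩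
    G (suc n) + (X^ n · h) (suc n) ∎
  [1+X]F≗G⊕Xⁿh-high (suc (suc t)) = begin
    F (2 ℕ.+ t ℕ.+ n) + F (suc t ℕ.+ n)
      ≡⟨ cong₂ _+_ (F> _ (s≤s (ℕₚ.≤-trans (ℕₚ.n≤1+n n) (s≤s (ℕₚ.m≤n+m n t))))) (F> _ (s≤s (ℕₚ.m≤n+m n t))) ⟩
    0ℚ + 0ℚ
      ≡⟨ solve 2 (λ d w → con 0ℚ :+ con 0ℚ := con 0ℚ :+ d :* (con 0ℚ :+ w :* con 0ℚ)) refl d two ⟩
    0ℚ + h (2 ℕ.+ t)
      ≡⟨ sym (cong₂ _+_ (G> _ (s≤s (ℕₚ.≤-trans (ℕₚ.n≤1+n m) (ℕₚ.m≤n+m n (suc t))))) (X^·-+ʳ n h (2 ℕ.+ t))) ⟩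
    (G ⊕ X^ n · h) (2 ℕ.+ t ℕ.+ n) ∎

  [1+X]F≗G⊕Xⁿh : [1+X]· F ≗ G ⊕ X^ n · h
  [1+X]F≗G⊕Xⁿh e = byDegree (e ℕ.≤? m)
    where
    byDegree : Dec (e ≤ m) → ([1+X]· F) e ≡ (G ⊕ X^ n · h) e
    byDegree (yes e≤m) = [1+X]F≗G⊕Xⁿh-low e e≤m
    byDegree (no e≰m)  = subst (λ z → ([1+X]· F) z ≡ (G ⊕ X^ n · h) z) (ℕₚ.m∸n+n≡m (ℕₚ.≰⇒> e≰m))
                               ([1+X]F≗G⊕Xⁿh-high (e ∸ n))

  H⊕XⁿR≗1+X : ∀ e → H e + (X^ n · R) e ≡ δ e + (X· δ) e
  H⊕XⁿR≗1+X e = begin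
    H e + (X^ n · R) e              ≡⟨ cong (H e +_) (sym (⋆-X^·ʳ n u h e)) ⟩
    (u ⋆ G) e + (u ⋆ X^ n · h) e    ≡⟨ sym (⋆-distribˡ-⊕ u G (X^ n · h) e) ⟩
    (u ⋆ (G ⊕ X^ n · h)) e          ≡⟨ ⋆-congʳ u (λ e′ → sym ([1+X]F≗G⊕Xⁿh e′)) e ⟩
    (u ⋆ [1+X]· F) e                ≡⟨ ⋆-[1+X]ʳ u F e ⟩
    ([1+X]· (u ⋆ F)) e              ≡⟨ [1+X]·-cong u⋆F e ⟩
    δ e + (X· δ) e                  ∎

  R₀ : R 0 ≡ d
  R₀ = solve 2 (λ d w → con 1ℚ :* (d :* (con 1ℚ :+ w :* con 0ℚ)) := d) refl d two

  W⋆R≗d•δ : W ⋆ R ≗ d • δ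
  W⋆R≗d•δ e = begin
    (W ⋆ (u ⋆ h)) e
      ≡⟨ ⋆-congʳ W (⋆-•ʳ d u (1+rX two)) e ⟩
    (W ⋆ d • (u ⋆ 1+rX two)) e
      ≡⟨ ⋆-•ʳ d W (u ⋆ 1+rX two) e ⟩
    d * ((F ⋆ geometric (- two)) ⋆ (u ⋆ 1+rX two)) e
      ≡⟨ cong (d *_) (⋆-assoc F (geometric (- two)) (u ⋆ 1+rX two) e) ⟩
    d * (F ⋆ (geometric (- two) ⋆ (u ⋆ 1+rX two))) e
      ≡⟨ cong (d *_) (⋆-congʳ F regroup e) ⟩
    d * (F ⋆ u) e
      ≡⟨ cong (d *_) (⋆-inverseʳ F F₀ e) ⟩
    d * δ e ∎
    where
    regroup : geometric (- two) ⋆ (u ⋆ 1+rX two) ≗ u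
    regroup x = begin
      (geometric (- two) ⋆ (u ⋆ 1+rX two)) x  ≡⟨ sym (⋆-assoc (geometric (- two)) u (1+rX two) x) ⟩
      ((geometric (- two) ⋆ u) ⋆ 1+rX two) x  ≡⟨ ⋆-congˡ (1+rX two) (⋆-comm (geometric (- two)) u) x ⟩
      ((u ⋆ geometric (- two)) ⋆ 1+rX two) x  ≡⟨ ⋆-assoc u (geometric (- two)) (1+rX two) x ⟩
      (u ⋆ (geometric (- two) ⋆ 1+rX two)) x  ≡⟨ ⋆-congʳ u (geometric-inverse two) x ⟩
      (u ⋆ δ) x                               ≡⟨ ⋆-identityʳ u x ⟩
      u x                                     ∎

  H≡1+X-XⁿR : ∀ e → H e ≡ δ e + (X· δ) e + (- (X^ n · R) e)
  H≡1+X-XⁿR e = trans (solve 2 (λ a b → a := (a :+ b) :+ (:- b)) refl (H e) ((X^ n · R) e))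
                      (cong (_+ (- (X^ n · R) e)) (H⊕XⁿR≗1+X e))

  H-row₀ : ∀ t → t ≤ m → H t ≡ (δ ⊕ X· δ) t
  H-row₀ t t≤m = trans (H≡1+X-XⁿR t) (trans (cong (λ z → δ t + (X· δ) t + (- z)) (X^·-< n R t (s≤s t≤m)))
                                            (+-identityʳ _))

  H-row₁ : ∀ t → t ≤ m → H (suc t) ≡ (δ ⊕ (- d) • X^ m · δ) t
  H-row₁ t t≤m = trans (H≡1+X-XⁿR (suc t)) (begin
    0ℚ + δ t + (- (X^ m · R) t)
      ≡⟨ cong (λ z → 0ℚ + δ t + (- z)) (XᵐR t t≤m) ⟩
    0ℚ + δ t + (- (d * (X^ m · δ) t))
      ≡⟨ solve 3 (λ a x y → con 0ℚ :+ a :+ (:- (x :* y)) := a :+ (:- x) :* y) refl (δ t) d ((X^ m · δ) t) ⟩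
    δ t + (- d) * (X^ m · δ) t ∎)
    where
    XᵐR : ∀ t → t ≤ m → (X^ m · R) t ≡ d * (X^ m · δ) t
    XᵐR t t≤m = trans (X^·-≤ m R t t≤m) (cong (_* (X^ m · δ) t) R₀)

  H-rowsBelow : ∀ i′ t → i′ < m′ → H (2 ℕ.+ i′ ℕ.+ t) ≡ (- 1ℚ) * (X^ (m′ ∸ i′) · R) t
  H-rowsBelow i′ t i′<m′ = trans (H≡1+X-XⁿR (2 ℕ.+ i′ ℕ.+ t)) (begin
    0ℚ + 0ℚ + (- (X^ n · R) (2 ℕ.+ i′ ℕ.+ t))
      ≡⟨ cong (λ z → 0ℚ + 0ℚ + (- z)) shifted ⟩
    0ℚ + 0ℚ + (- (X^ (m′ ∸ i′) · R) t)
      ≡⟨ solve 1 (λ a → con 0ℚ :+ con 0ℚ :+ (:- a) := (:- con 1ℚ) :* a) refl ((X^ (m′ ∸ i′) · R) t) ⟩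
    (- 1ℚ) * (X^ (m′ ∸ i′) · R) t ∎)
    where
    shifted : (X^ n · R) (2 ℕ.+ i′ ℕ.+ t) ≡ (X^ (m′ ∸ i′) · R) t
    shifted = trans (cong (λ z → (X^ (2 ℕ.+ z) · R) (2 ℕ.+ i′ ℕ.+ t)) (sym (ℕₚ.m+[n∸m]≡n (ℕₚ.<⇒≤ i′<m′))))
                    (X^·-++ (2 ℕ.+ i′) (m′ ∸ i′) R t)

  W₀ : W 0 ≡ 1ℚ
  W₀ = trans (cong (_* 1ℚ) F₀) (*-identityˡ 1ℚ)

  A : Matrix
  A i k = (W ⋆ (λ t → H (i ℕ.+ t))) (m ∸ k)

  A-row₀ : ∀ k → k ≤ m → A 0 k ≡ W (m ∸ k) + (X· W) (m ∸ k)
  A-row₀ k k≤m = begin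
    A 0 k
      ≡⟨ ⋆-congʳ-≤ (m ∸ k) W (λ t t≤ → H-row₀ t (ℕₚ.≤-trans t≤ (ℕₚ.m∸n≤m m k))) ⟩
    (W ⋆ (δ ⊕ X· δ)) (m ∸ k)
      ≡⟨ ⋆-distribˡ-⊕ W δ (X· δ) (m ∸ k) ⟩
    (W ⋆ δ) (m ∸ k) + (W ⋆ X· δ) (m ∸ k)
      ≡⟨ cong₂ _+_ (⋆-identityʳ W (m ∸ k)) (trans (⋆-X·ʳ W δ (m ∸ k)) (X·-cong (⋆-identityʳ W) (m ∸ k))) ⟩
    W (m ∸ k) + (X· W) (m ∸ k) ∎

  A-row₁ : ∀ k → k ≤ m → A 1 k ≡ W (m ∸ k) + (- d) * (X^ m · W) (m ∸ k)
  A-row₁ k k≤m = begin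
    A 1 k
      ≡⟨ ⋆-congʳ-≤ (m ∸ k) W (λ t t≤ → H-row₁ t (ℕₚ.≤-trans t≤ (ℕₚ.m∸n≤m m k))) ⟩
    (W ⋆ (δ ⊕ (- d) • X^ m · δ)) (m ∸ k)
      ≡⟨ ⋆-distribˡ-⊕ W δ ((- d) • X^ m · δ) (m ∸ k) ⟩
    (W ⋆ δ) (m ∸ k) + (W ⋆ (- d) • X^ m · δ) (m ∸ k)
      ≡⟨ cong₂ _+_ (⋆-identityʳ W (m ∸ k)) (trans (⋆-•ʳ (- d) W (X^ m · δ) (m ∸ k))
         (cong ((- d) *_) (trans (⋆-X^·ʳ m W δ (m ∸ k)) (X^·-cong m (⋆-identityʳ W) (m ∸ k))))) ⟩
    W (m ∸ k) + (- d) * (X^ m · W) (m ∸ k)             ∎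

  A-rowsBelow : ∀ i′ k → i′ < m′ → A (2 ℕ.+ i′) k ≡ (- d) * (X^ (m′ ∸ i′) · δ) (m ∸ k)
  A-rowsBelow i′ k i′<m′ = begin
    A (2 ℕ.+ i′) k
      ≡⟨ ⋆-congʳ W (λ t → H-rowsBelow i′ t i′<m′) (m ∸ k) ⟩
    (W ⋆ (- 1ℚ) • X^ (m′ ∸ i′) · R) (m ∸ k)
      ≡⟨ ⋆-•ʳ (- 1ℚ) W (X^ (m′ ∸ i′) · R) (m ∸ k) ⟩
    (- 1ℚ) * (W ⋆ X^ (m′ ∸ i′) · R) (m ∸ k)
      ≡⟨ cong ((- 1ℚ) *_) (⋆-X^·ʳ (m′ ∸ i′) W R (m ∸ k)) ⟩
    (- 1ℚ) * (X^ (m′ ∸ i′) · (W ⋆ R)) (m ∸ k)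
      ≡⟨ cong ((- 1ℚ) *_) (X^·-cong (m′ ∸ i′) W⋆R≗d•δ (m ∸ k)) ⟩
    (- 1ℚ) * (X^ (m′ ∸ i′) · (d • δ)) (m ∸ k)
      ≡⟨ cong ((- 1ℚ) *_) (X^·-• (m′ ∸ i′) d δ (m ∸ k)) ⟩
    (- 1ℚ) * (d * (X^ (m′ ∸ i′) · δ) (m ∸ k))
      ≡⟨ solve 2 (λ d x → (:- con 1ℚ) :* (d :* x) := (:- d) :* x) refl d ((X^ (m′ ∸ i′) · δ) (m ∸ k)) ⟩
    (- d) * (X^ (m′ ∸ i′) · δ) (m ∸ k) ∎

  A-rowsBelow-diag : ∀ i′ → i′ < m′ → A (2 ℕ.+ i′) (suc i′) ≡ - d
  A-rowsBelow-diag i′ i′<m′ =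
    trans (A-rowsBelow i′ (suc i′) i′<m′) (trans (cong ((- d) *_) (X^·δ-diag (m′ ∸ i′))) (*-identityʳ (- d)))

  A-rowsBelow-off : ∀ i′ k → i′ < m′ → k ≤ m → k ≢ suc i′ → A (2 ℕ.+ i′) k ≡ 0ℚ
  A-rowsBelow-off i′ k i′<m′ k≤m k≢i′+1 =
    trans (A-rowsBelow i′ k i′<m′) (trans (cong ((- d) *_) (X^·δ-off (m′ ∸ i′) (m ∸ k) m∸k≢m′∸i′)) (*-zeroʳ (- d)))
    where
    m∸k≢m′∸i′ : m ∸ k ≢ m′ ∸ i′
    m∸k≢m′∸i′ eq = k≢i′+1 (begin
      k                  ≡⟨ sym (ℕₚ.m∸[m∸n]≡n k≤m) ⟩
      m ∸ (m ∸ k)        ≡⟨ cong (m ∸_) eq ⟩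
      m ∸ (m ∸ suc i′)   ≡⟨ ℕₚ.m∸[m∸n]≡n (s≤s (ℕₚ.<⇒≤ i′<m′)) ⟩
      suc i′             ∎)

  expandFirstRow : detℕ n A ≡ 1ℚ * (A 0 0 * (sign m′ * (A 1 m * (- d) ^ℚ m′))) + sign m * (A 0 m * (A 1 0 * (- d) ^ℚ m′))
  expandFirstRow = trans (∑-ends m′ term middle) (cong₂ (λ x y → 1ℚ * (A 0 0 * x) + sign m * (A 0 m * y)) minor₀ minorₘ)
    where
    term : ℕ → ℚ
    term k = sign k * (A 0 k * detℕ m (minor k A))
    middle : ∀ k → 1 ≤ k → k ≤ m′ → term k ≡ 0ℚ
    middle (suc k) _ k<m′ = trans
      (cong (λ z → sign (suc k) * (A 0 (suc k) * z))
            (detℕ-zeroRow m (minor (suc k) A) (suc k) (s≤s k<m′)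
              (λ c c< → A-rowsBelow-off k (punchInℕ (suc k) c) k<m′ (ℕₚ.≤-pred (punchInℕ-bounded m (suc k) c c<))
                          (punchInℕ-≢ (suc k) c))))
      (solve 2 (λ s x → s :* (x :* con 0ℚ) := con 0ℚ) refl (sign (suc k)) (A 0 (suc k)))
    minor₀ : detℕ m (minor 0 A) ≡ sign m′ * (A 1 m * (- d) ^ℚ m′)
    minor₀ = detℕ-lowerRowsSubdiagonal m′ (minor 0 A) (- d) (λ i i< → A-rowsBelow-diag i i<)
      (λ i c i< c≤ c≢i → A-rowsBelow-off i (suc c) i< (s≤s c≤) (λ e → c≢i (ℕₚ.suc-injective e)))
    minorₘ : detℕ m (minor m A) ≡ A 1 0 * (- d) ^ℚ m′
    minorₘ = detℕ-lowerRowsDiagonal m′ (minor m A) (- d)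
      (λ i i< → trans (cong (A (2 ℕ.+ i)) (punchInℕ-below m (suc i) (s≤s i<))) (A-rowsBelow-diag i i<))
      (λ i c i< c≤ c≢ → trans (cong (A (2 ℕ.+ i)) (punchInℕ-below m c (s≤s c≤)))
                              (A-rowsBelow-off i c i< (ℕₚ.m≤n⇒m≤1+n c≤) c≢))

  A₀₀ : A 0 0 ≡ W m + W m′
  A₀₀ = A-row₀ 0 z≤n

  A₀ₘ : A 0 m ≡ 1ℚ
  A₀ₘ = trans (A-row₀ m ℕₚ.≤-refl) (trans (cong (λ z → W z + (X· W) z) (ℕₚ.n∸n≡0 m)) (trans (+-identityʳ (W 0)) W₀))

  A₁₀ : A 1 0 ≡ W m + (- d) * 1ℚ
  A₁₀ = trans (A-row₁ 0 z≤n) (cong (λ z → W m + (- d) * z) (trans (X^·-+ʳ m W 0) W₀))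

  A₁ₘ : A 1 m ≡ 1ℚ
  A₁ₘ = trans (A-row₁ m ℕₚ.≤-refl) (begin
    W (m ∸ m) + (- d) * (X^ m · W) (m ∸ m)  ≡⟨ cong (λ z → W z + (- d) * (X^ m · W) z) (ℕₚ.n∸n≡0 m) ⟩
    W 0 + (- d) * (X^ m · W) 0              ≡⟨ cong₂ (λ x y → x + (- d) * y) W₀ (X^·-< m W 0 (s≤s z≤n)) ⟩
    1ℚ + (- d) * 0ℚ                         ≡⟨ solve 1 (λ x → con 1ℚ :+ (:- x) :* con 0ℚ := con 1ℚ) refl d ⟩
    1ℚ                                      ∎)

  W+d≡±4^m : W m′ + d ≡ sign m′ * four ^ℚ m
  W+d≡±4^m = begin
    W m′ + d                      ≡⟨ cong (_+ d) W-signed ⟩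
    sign m′ * V + sign m′ * Y     ≡⟨ sym (*-distribˡ-+ (sign m′) V Y) ⟩
    sign m′ * (V + Y)             ≡⟨ cong (sign m′ *_) (nearCentralBinomialSum m′) ⟩
    sign m′ * four ^ℚ m           ∎
    where
    V Y : ℚ
    V = (C⁺ n ⋆ geometric two) m′
    Y = C⁺ m n
    W-signed : W m′ ≡ sign m′ * V
    W-signed = begin
      (F ⋆ geometric (- two)) m′
        ≡⟨ ⋆-congˡ-≤ m′ (geometric (- two)) (λ i i≤m′ → F≤ i (ℕₚ.≤-trans i≤m′ (ℕₚ.m≤n+m m′ 2))) ⟩
      (Qcoeff n ⋆ geometric (- two)) m′
        ≡⟨ ⋆-congʳ (Qcoeff n) (geometric-neg two) m′ ⟩
      (signed (C⁺ n) ⋆ signed (geometric two)) m′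
        ≡⟨ ⋆-signed (C⁺ n) (geometric two) m′ ⟩
      sign m′ * V ∎

  detℕ-A : detℕ n A ≡ sign m′ * (- d) ^ℚ m′ * (W m′ + d)
  detℕ-A = begin
    detℕ n A
      ≡⟨ expandFirstRow ⟩
    1ℚ * (A 0 0 * (sign m′ * (A 1 m * a))) + sign m * (A 0 m * (A 1 0 * a))
      ≡⟨ cong₂ _+_ (cong₂ (λ x y → 1ℚ * (x * (sign m′ * (y * a)))) A₀₀ A₁ₘ)
                   (trans (cong₂ (λ σ x → σ * (x * (A 1 0 * a))) (sign-suc m′) A₀ₘ)
                          (cong (λ y → (- sign m′) * (1ℚ * (y * a))) A₁₀)) ⟩
    1ℚ * ((W m + W m′) * (sign m′ * (1ℚ * a))) + (- sign m′) * (1ℚ * ((W m + (- d) * 1ℚ) * a))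
      ≡⟨ solve 5 (λ s a w w′ x → con 1ℚ :* ((w :+ w′) :* (s :* (con 1ℚ :* a)))
                                 :+ (:- s) :* (con 1ℚ :* ((w :+ (:- x) :* con 1ℚ) :* a))
                                 := s :* a :* (w′ :+ x))
           refl (sign m′) a (W m) (W m′) d ⟩
    sign m′ * a * (W m′ + d)
      ∎
    where
    a : ℚ
    a = (- d) ^ℚ m′

  detℕ-sylvester : detℕ (n ℕ.+ m) (sylvesterℕ f g n m) ≡ two ^ℚ n * (two * C⁺ m n) ^ℚ m′
  detℕ-sylvester = begin
    detℕ (n ℕ.+ m) (sylvesterℕ f g n m)
      ≡⟨ sylvester≡rowSeries ⟩
    detℕ (suc D) (λ r c → rowSeries r (D ∸ c))
      ≡⟨ detℕ-⋆-rows D rowSeries u refl ⟩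
    detℕ (suc D) S
      ≡⟨ peelUnitRows ⟩
    sign n ^ℚ m * detℕ n (λ i → S (m ℕ.+ i))
      ≡⟨ cong (sign n ^ℚ m *_) lowerRows≡H ⟩
    sign n ^ℚ m * detℕ n (λ i k → H (i ℕ.+ (m ∸ k)))
      ≡⟨ cong (sign n ^ℚ m *_) (detℕ-⋆-rows m (λ i t → H (i ℕ.+ t)) W W₀) ⟩
    sign n ^ℚ m * detℕ n A
      ≡⟨ cong (sign n ^ℚ m *_) detℕ-A ⟩
    sign m′ ^ℚ m * (sign m′ * (- d) ^ℚ m′ * (W m′ + d))
      ≡⟨ closedForm m′ (W m′) (C⁺ m n) W+d≡±4^m ⟩
    two ^ℚ n * (two * C⁺ m n) ^ℚ m′ ∎

deg-Q : ∀ n (P Q : Vec ℚ (suc n)) → BezoutIdentity (suc n) P Q → deg (toList Q) ≡ n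
deg-Q n P Q bezout = deg-toList n Q (λ lead≡0 →
  Qcoeff-nonZero n n (trans (sym (bezout⇒coeff n P Q bezout n ℕₚ.≤-refl)) lead≡0))

open import Data.Integer using (+_; _-_)

theorem6p1 : (n : ℕ) → 1 ≤ n →
    (P Q : Vec ℚ (suc n)) → (P' Q' : Vec ℚ n) →
    ((toList P *ₚ xPow (suc n)) +ₚ (toList Q *ₚ x+1Pow (suc n))) ≈ₚ onePoly →
    ((toList P' *ₚ xPow n) +ₚ (toList Q' *ₚ x+1Pow n)) ≈ₚ onePoly →
    resultant (toList Q) (toList Q') ≡ ((+ (2 ^ n)) / 1) * natPowℤ ((2 Data.Nat.* n) C n) (+ n - + 2)
theorem6p1 zero ()
theorem6p1 (suc zero) _ P Q P′ Q′ bezout₁ bezout₀ = begin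
  resultant (toList Q) (toList Q′)
    ≡⟨ resultant≡detℕ (toList Q) (toList Q′) 1 0 (deg-Q 1 P Q bezout₁) (deg-Q 0 P′ Q′ bezout₀) ⟩
  1ℚ * (coeff (toList Q′) 0 * 1ℚ) + 0ℚ
    ≡⟨ cong (λ z → 1ℚ * (z * 1ℚ) + 0ℚ) (bezout⇒coeff 0 P′ Q′ bezout₀ 0 z≤n) ⟩
  1ℚ * (1ℚ * 1ℚ) + 0ℚ
    ≡⟨⟩ -- the exponent n - 2 is -1 here, and natPowℤ 2 (-1) = 1/2
  (+ 2) / 1 * natPowℤ 2 (+ 1 - + 2) ∎
theorem6p1 (suc (suc m′)) _ P Q P′ Q′ bezoutₙ bezoutₘ = begin
  resultant (toList Q) (toList Q′)
    ≡⟨ resultant≡detℕ (toList Q) (toList Q′) n m (deg-Q n P Q bezoutₙ) (deg-Q m P′ Q′ bezoutₘ) ⟩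
  detℕ (n ℕ.+ m) (sylvesterℕ (toList Q) (toList Q′) n m)
    ≡⟨ Sylvester.detℕ-sylvester ⟩
  two ^ℚ n * (two * C⁺ m n) ^ℚ m′
    ≡⟨ sym (cong₂ _*_ (fromℕ-^ 2 n) (trans (fromℕ-^ ((2 ℕ.* n) C n) m′) (cong (_^ℚ m′) central))) ⟩
  fromℕ (2 ^ n) * fromℕ (((2 ℕ.* n) C n) ^ m′) ∎
  where
  m n : ℕ
  m = suc m′
  n = suc m
  module Sylvester = SylvesterDeterminant m′ (toList Q) (toList Q′)
    (bezout⇒coeff n P Q bezoutₙ) (coeff-toList-≥ Q) (bezout⇒coeff m P′ Q′ bezoutₘ) (coeff-toList-≥ Q′)
  central : fromℕ ((2 ℕ.* n) C n) ≡ two * C⁺ m n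
  central = trans (cong (λ z → fromℕ ((n ℕ.+ z) C n)) (ℕₚ.+-identityʳ n)) (C⁺-diagonal m)
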